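{- Let $Q=2^m$ and let $a,b,c\in\mathbb F_Q$ with $a+b+c\in T_0$ and $c\ne0$. Let $e\in\mathbb F_2$, $\epsilon=(-1)^e$, and $v\in\mathbb F_Q$ with $\mathrm{Tr}(v)=e$. Let $\ell,m$ be distinct non-tangent lines with $\ell\in\mathcal L_\epsilon$ and $\hat\rho(\ell,m)=c$, and let $\pi^c_{a,b}(\epsilon)$ be the number of non-tangent lines $n$ (including possibly $\ell$ or $m$) with $\hat\rho(\ell,n)=a$ and $\hat\rho(n,m)=b$. Then $$\pi^c_{a,b}(\epsilon)=\sum_\tau\bigl|\{z\in\mathbb F_Q\cup\{\infty\}:z^2+z=v+ac/\tau^2\}\bigr|=\begin{cases}1+2|T_e\cap\{ac\}|,&\text{if }a+b+c=0,\\ 2\sum_\tau|T_e\cap\{ac/\tau^2\}|,&\text{if }a+b+c\in T_0^*.\end{cases}$$ Here both sums run over the two elements $\tau\in\mathbb F_Q$ with $\tau^2+\tau=a+b+c$. By convention, for $\tau=0$ the equation $z^2+z=v+ac/\tau^2$ has $z=\infty$ as its only solution.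
   Context: Let $Q=2^m$ and work in $\mathrm{PG}(2,Q)$. Conic and lines. - Points are nonzero vectors up to scalars, and $(a,b,c)^\perp$ denotes the line $aX+bY+cZ=0$. - The conic is $\mathcal O=\{(\xi,\xi^2,1)^\top:\xi\in\mathbb F_Q\}\cup\{(0,1,0)^\top\}$. - The non-tangent lines (meeting $\mathcal O$ in $0$ or $2$ points) are exactly the lines $(1,x,y)^\perp$, $x,y\in\mathbb F_Q$. - Such a line lies in $\mathcal L_1$ (secant) if $\mathrm{Tr}(xy)=0$ and in $\mathcal L_{ -1}$ (exterior) if $\mathrm{Tr}(xy)=1$, where $\mathrm{Tr}$ is the absolute trace $\mathbb F_Q\to\mathbb F_2$. Modified cross-ratio. - For $\ell=(1,x,y)^\perp$ and $n=(1,z,u)^\perp$: $\hat\rho(\ell,n)=x^2u^2+y^2z^2+(x+z)(y+u)$. Other notation. - $T_e=\{x\in\mathbb F_Q:\mathrm{Tr}(x)=e\}$ and $T_0^*=T_0\setminus\{0\}$. -}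

module Defs where

open import Level using (Level; _⊔_) renaming (suc to lsuc)
open import Data.Nat using (ℕ; zero; suc; _^_)
open import Data.Bool using (Bool; true; false)
open import Data.Product using (_×_; _,_; proj₁; proj₂)
open import Data.List using (List; length; filter; cartesianProduct)
open import Data.List.Relation.Unary.Any using (Any)
open import Relation.Nullary using (¬_; Dec; yes; no)
open import Relation.Nullary.Decidable using (_×-dec_)
open import Relation.Binary using (Decidable)
open import Relation.Binary.PropositionalEquality using (_≡_)
open import Algebra.Bundles using (CommutativeRing)
import Data.List.Relation.Unary.Unique.Setoid as UniqueS

-- A finite field of order Q = 2^m, given as a commutative ring with
-- (i) a multiplicative inverse on nonzero elements, 1 ≠ 0,
-- (ii) decidable equality, (iii) an exhaustive duplicate-free
-- enumeration of its elements of length 2^m, and characteristic 2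
-- (the last is automatic for a field of order 2^m).
record FiniteField2 (c ℓ : Level) (m : ℕ) : Set (lsuc (c ⊔ ℓ)) where
  field
    cring : CommutativeRing c ℓ
  open CommutativeRing cring public
  field
    _⁻¹      : Carrier → Carrier
    inverseʳ : ∀ x → ¬ (x ≈ 0#) → (x * (x ⁻¹)) ≈ 1#
    1≉0      : ¬ (1# ≈ 0#)
    _≟_      : Decidable _≈_
    elems    : List Carrier
    complete : ∀ x → Any (x ≈_) elems
    unique   : UniqueS.Unique setoid elems
    card     : length elems ≡ 2 ^ m
    char2    : (1# + 1#) ≈ 0#

  infixl 6 _⊕_
  infixl 7 _⊗_
  _⊕_ : Carrier → Carrier → Carrier
  _⊕_ = _+_
  _⊗_ : Carrier → Carrier → Carrier
  _⊗_ = _*_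

  infix 8 _²
  _² : Carrier → Carrier
  x ² = x * x

  sqIter : ℕ → Carrier → Carrier
  sqIter zero    x = x
  sqIter (suc i) x = (sqIter i x) ²

  -- absolute trace  Tr(x) = x + x^2 + x^4 + ... + x^(2^(m-1))
  trAux : ℕ → Carrier → Carrier
  trAux zero    x = 0#
  trAux (suc i) x = trAux i x + sqIter i x

  Tr : Carrier → Carrier
  Tr = trAux m

  ⟦_⟧ : Bool → Carrier
  ⟦ false ⟧ = 0#
  ⟦ true  ⟧ = 1#

  -- the non-tangent line (1,x,y)^⊥ is represented by the pair (x , y)
  Line : Set c
  Line = Carrier × Carrier

  ρ̂ : Line → Line → Carrier
  ρ̂ (x , y) (z , u) = (x ² * u ²) + (y ² * z ²) + ((x + z) * (y + u))

  allLines : List Line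
  allLines = cartesianProduct elems elems

  countπ : Line → Line → Carrier → Carrier → ℕ
  countπ ℓ' m' a b =
    length (filter (λ n → (ρ̂ ℓ' n ≟ a) ×-dec (ρ̂ n m' ≟ b)) allLines)

  rootsOf : Carrier → List Carrier
  rootsOf s = filter (λ τ → ((τ ²) + τ) ≟ s) elems

  solCount : Carrier → Carrier → Carrier → ℕ
  solCount v w τ with τ ≟ 0#
  ... | yes _ = 1
  ... | no  _ = length (filter (λ z → ((z ²) + z) ≟ (v + (w * ((τ ²) ⁻¹)))) elems)

  inT : Bool → Carrier → ℕ
  inT e x with Tr x ≟ ⟦ e ⟧
  ... | yes _ = 1
  ... | no  _ = 0

{-# OPTIONS --safe #-}
-- Write n = ℓ + w. Then ρ̂ (ℓ , n) = q w := ω (ℓ , w)² + w₁ w₂ is a quadratic form whose polar form is the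
-- alternating form ω (v , w) = v₁ w₂ + v₂ w₁, and with d = ℓ + m one has
--   ρ̂ (ℓ , n) + ρ̂ (n , m) + ρ̂ (ℓ , m) = G² + G,  where G = ω (ℓ + n , d).
-- So the lines counted by π split into classes G = τ, one for each root τ of τ² + τ = a + b + c. Choosing e
-- with ω (d , e) = 1, the lines with G = τ are ℓ + t d + τ e, and on them ρ̂ (ℓ , n) = c t² + τ t + τ² q e.
-- For τ = 0 the equation c t² = a has one solution, squaring being bijective; for τ ≠ 0 the substitution
-- t = τ z / c turns it into z² + z = a c / τ² + c q e. An equation z² + z = k has 2 or 0 solutions according
-- as Tr k is 0 or 1: each has at most 2 solutions, none if Tr k = 1 since Tr (z² + z) = z^Q + z = 0 by
-- Fermat, and Q = Σ_k #{z | z² + z = k} ≤ 2 |ker Tr| ≤ Q because Tr is a polynomial of degree Q / 2.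
-- Finally Tr (c q e) = Tr (x y) = Tr v, as c q e and x y are Arf invariants of q in two symplectic bases.
module Submission where

open import Defs
open import Level using (Level)
open import Data.Nat using (ℕ)
import Data.Nat as N
open import Data.Bool using (Bool)
open import Data.Product using (_×_; _,_)
open import Data.List using (map)
open import Data.Nat.ListAction using (sum)
open import Relation.Nullary using (¬_)
open import Relation.Binary.PropositionalEquality using (_≡_)
import Relation.Binary.PropositionalEquality as ≡
open import Relation.Binary using (Setoid)
import Relation.Binary as Binary
open import Algebra.Bundles using (CommutativeRing; CommutativeMonoid)

module Counting where

  open import Data.Nat using (ℕ; suc; _+_; _*_; _≤_; z≤n; s≤s)
  open import Data.Nat.Properties
  open import Algebra.Properties.CommutativeSemigroup +-commutativeSemigroup using (x∙yz≈y∙xz)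
  open import Data.List using (List; []; _∷_; length; filter; map)
  open import Data.List.Properties using (filter-≐; filter-none)
  open import Data.Nat.ListAction using (sum)
  open import Data.List.Relation.Unary.Any using (Any; here; there)
  open import Data.List.Relation.Unary.All using (All; []; _∷_)
  open import Data.List.Relation.Unary.All.Properties using (¬Any⇒All¬)
  open import Relation.Unary using (Pred; Decidable; _≐_)
  open import Relation.Nullary using (¬_; Dec; yes; no)
  open import Relation.Nullary.Decidable using (_×-dec_; ¬?)
  open import Data.Product using (_×_; _,_)
  open import Data.Sum using (_⊎_; inj₁; inj₂)
  open import Data.Empty using (⊥-elim)
  open import Relation.Binary.PropositionalEquality
    using (_≡_; refl; cong; cong₂; sym; trans)

  private
    +-exchange : ∀ x y z → x + (y + z) ≡ y + (x + z)
    +-exchange = x∙yz≈y∙xz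

  count : ∀ {a p} {A : Set a} {P : Pred A p} → Decidable P → List A → ℕ
  count P? xs = length (filter P? xs)

  module _ {a} {A : Set a} where

    module _ {p q} {P : Pred A p} {R : Pred A q} (P? : Decidable P) (R? : Decidable R) where

      count-cong : P ≐ R → ∀ xs → count P? xs ≡ count R? xs
      count-cong P≐R xs = cong length (filter-≐ P? R? P≐R xs)

      count-split : ∀ xs → count P? xs ≡ count (λ x → P? x ×-dec R? x) xs + count (λ x → P? x ×-dec ¬? (R? x)) xs
      count-split [] = refl
      count-split (x ∷ xs) with P? x | R? x
      ... | yes _ | yes _ = cong suc (count-split xs)
      ... | yes _ | no _ = trans (cong suc (count-split xs)) (sym (+-suc _ _))
      ... | no _ | _ = count-split xs

      count-filter : ∀ xs → count P? (filter R? xs) ≡ count (λ x → R? x ×-dec P? x) xs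
      count-filter [] = refl
      count-filter (x ∷ xs) with R? x
      ... | no _ = count-filter xs
      ... | yes _ with P? x
      ...   | yes _ = cong suc (count-filter xs)
      ...   | no _ = count-filter xs

    module _ {p q r} {P : Pred A p} {R : Pred A q} {T : Pred A r}
             (P? : Decidable P) (R? : Decidable R) (T? : Decidable T) where

      count-≤-+ : (∀ {x} → P x → R x ⊎ T x) → ∀ xs → count P? xs ≤ count R? xs + count T? xs
      count-≤-+ P⇒R⊎T [] = z≤n
      count-≤-+ P⇒R⊎T (x ∷ xs) with ih ← count-≤-+ P⇒R⊎T xs | P? x | R? x | T? x
      ... | no _  | yes _ | yes _ = ≤-trans ih (+-mono-≤ (n≤1+n _) (n≤1+n _))
      ... | no _  | yes _ | no _  = ≤-trans ih (n≤1+n _)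
      ... | no _  | no _  | yes _ = ≤-trans ih (+-monoʳ-≤ (count R? xs) (n≤1+n _))
      ... | no _  | no _  | no _  = ih
      ... | yes _ | yes _ | yes _ = s≤s (≤-trans ih (+-monoʳ-≤ (count R? xs) (n≤1+n _)))
      ... | yes _ | yes _ | no _  = s≤s ih
      ... | yes _ | no _  | yes _ = ≤-trans (s≤s ih) (≤-reflexive (sym (+-suc _ _)))
      ... | yes px | no ¬r | no ¬t with P⇒R⊎T px
      ...   | inj₁ r = ⊥-elim (¬r r)
      ...   | inj₂ t = ⊥-elim (¬t t)

    module _ {p} {P : Pred A p} (P? : Decidable P) where

      count-¬Any : ∀ {xs} → ¬ Any P xs → count P? xs ≡ 0
      count-¬Any ¬any = cong length (filter-none P? (¬Any⇒All¬ _ ¬any))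

      count-≥1 : ∀ {xs} → Any P xs → 1 ≤ count P? xs
      count-≥1 {x ∷ xs} any with P? x | any
      ... | yes _ | _ = s≤s z≤n
      ... | no ¬px | here px = ⊥-elim (¬px px)
      ... | no _ | there any′ = count-≥1 any′

      count-+-count-¬ : ∀ xs → count P? xs + count (λ x → ¬? (P? x)) xs ≡ length xs
      count-+-count-¬ [] = refl
      count-+-count-¬ (x ∷ xs) with P? x
      ... | yes _ = cong suc (count-+-count-¬ xs)
      ... | no _ = trans (+-suc _ _) (cong suc (count-+-count-¬ xs))

      sum-two-valued : (f : A → ℕ) (X Y : ℕ) → ∀ xs →
        All (λ x → (P x → f x ≡ X) × (¬ P x → f x ≡ Y)) xs →
        sum (map f xs) ≡ count P? xs * X + count (λ x → ¬? (P? x)) xs * Y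
      sum-two-valued f X Y [] [] = refl
      sum-two-valued f X Y (x ∷ xs) ((if-P , if-¬P) ∷ rest) with ih ← sum-two-valued f X Y xs rest | P? x
      ... | yes px = trans (cong₂ _+_ (if-P px) ih) (sym (+-assoc X _ _))
      ... | no ¬px = trans (cong₂ _+_ (if-¬P ¬px) ih) (+-exchange Y (count P? xs * X) _)

    sum-cong : ∀ {f g : A → ℕ} {xs} → All (λ x → f x ≡ g x) xs → sum (map f xs) ≡ sum (map g xs)
    sum-cong [] = refl
    sum-cong (fx≡gx ∷ rest) = cong₂ _+_ fx≡gx (sum-cong rest)

    sum-mono : ∀ {f g : A → ℕ} → (∀ x → f x ≤ g x) → ∀ xs → sum (map f xs) ≤ sum (map g xs)
    sum-mono f≤g [] = z≤n
    sum-mono f≤g (x ∷ xs) = +-mono-≤ (f≤g x) (sum-mono f≤g xs)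

    sum-*ˡ : ∀ k (f : A → ℕ) xs → sum (map (λ x → k * f x) xs) ≡ k * sum (map f xs)
    sum-*ˡ k f [] = sym (*-zeroʳ k)
    sum-*ˡ k f (x ∷ xs) = trans (cong (k * f x +_) (sum-*ˡ k f xs)) (sym (*-distribˡ-+ k (f x) _))

    sum-const-0 : ∀ xs → sum (map (λ (_ : A) → 0) xs) ≡ 0
    sum-const-0 [] = refl
    sum-const-0 (_ ∷ xs) = sum-const-0 xs

    sum-const-1 : ∀ xs → sum (map (λ (_ : A) → 1) xs) ≡ length xs
    sum-const-1 [] = refl
    sum-const-1 (_ ∷ xs) = cong suc (sum-const-1 xs)

    sum-≤-sum⇒pointwise-≡ : ∀ {f g : A → ℕ} → (∀ x → f x ≤ g x) →
      ∀ xs → sum (map g xs) ≤ sum (map f xs) → All (λ x → f x ≡ g x) xs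
    sum-≤-sum⇒pointwise-≡ f≤g [] _ = []
    sum-≤-sum⇒pointwise-≡ {f} {g} f≤g (x ∷ xs) Σg≤Σf =
      ≤-antisym (f≤g x) gx≤fx ∷ sum-≤-sum⇒pointwise-≡ f≤g xs Σg≤Σf′
      where
      gx≤fx : g x ≤ f x
      gx≤fx = +-cancelʳ-≤ (sum (map f xs)) (g x) (f x)
                (≤-trans (+-monoʳ-≤ (g x) (sum-mono f≤g xs)) Σg≤Σf)
      Σg≤Σf′ : sum (map g xs) ≤ sum (map f xs)
      Σg≤Σf′ = +-cancelˡ-≤ (f x) _ _ (≤-trans (+-monoˡ-≤ (sum (map g xs)) (f≤g x)) Σg≤Σf)

  module _ {a b r} {A : Set a} {B : Set b} {R : A → B → Set r} (R? : ∀ x y → Dec (R x y)) where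

    count-double : ∀ (xs : List A) (ys : List B) →
      sum (map (λ x → count (R? x) ys) xs) ≡ sum (map (λ y → count (λ x → R? x y) xs) ys)
    count-double [] ys = sym (sum-const-0 ys)
    count-double (x ∷ xs) ys = trans (cong (count (R? x) ys +_) (count-double xs ys)) (add-row ys)
      where
      column : B → ℕ
      column y = count (λ x′ → R? x′ y) xs
      column′ : B → ℕ
      column′ y = count (λ x′ → R? x′ y) (x ∷ xs)
      exchange : ∀ y ys → count (R? x) ys + sum (map column ys) ≡ sum (map column′ ys) →
                 count (R? x) ys + (column y + sum (map column ys)) ≡ column y + sum (map column′ ys)
      exchange y ys ih = trans (+-exchange (count (R? x) ys) (column y) _) (cong (column y +_) ih)
      add-row : ∀ ys → count (R? x) ys + sum (map column ys) ≡ sum (map column′ ys)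
      add-row [] = refl
      add-row (y ∷ ys) with R? x y | add-row ys
      ... | yes _ | ih = cong suc (exchange y ys ih)
      ... | no _ | ih = exchange y ys ih

module SetoidCounting {a ℓ} (S : Setoid a ℓ) (_≟_ : Binary.Decidable (Setoid._≈_ S)) where

  open import Data.Nat using (suc; _+_; _≤_; z≤n; s≤s)
  open import Data.Nat.Properties using (≤-antisym; ≤-trans; ≤-reflexive; +-mono-≤; module ≤-Reasoning)
  open import Data.List using (List; []; _∷_; length; filter; map)
  open import Data.List.Properties using (length-map)
  open import Data.Nat.ListAction using (sum)
  open import Data.List.Relation.Unary.Any as Any using (Any; here; there; satisfied)
  open import Data.List.Relation.Unary.All as All using (All; []; _∷_)
  open import Data.List.Relation.Unary.All.Properties using (all-filter)
  import Data.List.Relation.Unary.All.Properties as All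
  open import Data.List.Membership.Setoid S using (_∈_)
  open import Data.List.Membership.Setoid.Properties using (∈-filter⁺)
  open import Data.List.Relation.Unary.Unique.Setoid using (Unique)
  open import Data.List.Relation.Unary.AllPairs using ([]; _∷_)
  import Data.List.Relation.Unary.Unique.Setoid.Properties as Unique
  open import Relation.Unary using (Pred; Decidable)
  open import Relation.Nullary using (¬_; yes; no)
  open import Relation.Nullary.Decidable using (_×-dec_; ¬?)
  open import Data.Product using (_×_; _,_; proj₂)
  open import Function using (case_of_)
  open import Data.Empty using (⊥-elim)
  open import Relation.Binary.PropositionalEquality as ≡ using (_≡_)
  open import Relation.Binary.Definitions using (_Respects_)
  open Counting

  open Setoid S renaming (Carrier to A)

  module _ {p} {P : Pred A p} (P? : Decidable P) where

    count-≤1 : (∀ {x y} → P x → P y → x ≈ y) → ∀ {xs} → Unique S xs → count P? xs ≤ 1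
    count-≤1 P-subsingleton {[]} _ = z≤n
    count-≤1 P-subsingleton {x ∷ xs} (x∉xs ∷ xs!) with P? x
    ... | no _ = count-≤1 P-subsingleton xs!
    ... | yes px = s≤s (≤-reflexive (count-¬Any P? (λ any → none x∉xs any)))
      where
      none : ∀ {ys} → All (λ y → ¬ x ≈ y) ys → ¬ Any P ys
      none (x≉y ∷ _) (here py) = x≉y (P-subsingleton px py)
      none (_ ∷ rest) (there any) = none rest any

    count-≡1 : P Respects _≈_ → ∀ {xs} → Unique S xs → ∀ r → r ∈ xs → P r →
               (∀ {x} → P x → x ≈ r) → count P? xs ≡ 1
    count-≡1 resp xs! r r∈xs pr P⇒≈r =
      ≤-antisym (count-≤1 (λ px py → trans (P⇒≈r px) (sym (P⇒≈r py))) xs!)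
                (count-≥1 P? (Any.map (λ r≈x → resp r≈x pr) r∈xs))

  unique-⊆⇒length-≤ : ∀ {xs} ys → Unique S xs → All (_∈ ys) xs → length xs ≤ length ys
  unique-⊆⇒length-≤ {[]} _ _ _ = z≤n
  unique-⊆⇒length-≤ {_ ∷ _} [] _ (() ∷ _)
  unique-⊆⇒length-≤ {xs} (y ∷ ys) xs! xs⊆y∷ys = begin
    length xs                                               ≡⟨ count-+-count-¬ (_≟ y) xs ⟨
    count (_≟ y) xs + count (λ x → ¬? (x ≟ y)) xs           ≤⟨ +-mono-≤ (count-≤1 (_≟ y) (λ p q → trans p (sym q)) xs!)
                                                                        (unique-⊆⇒length-≤ ys (Unique.filter⁺ S _ xs!) (others xs xs⊆y∷ys)) ⟩
    suc (length ys) ∎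
    where
    open ≤-Reasoning
    others : ∀ xs → All (_∈ (y ∷ ys)) xs → All (_∈ ys) (filter (λ x → ¬? (x ≟ y)) xs)
    others [] [] = []
    others (x ∷ xs) (x∈ ∷ rest) with x ≟ y | x∈
    ... | yes _ | _ = others xs rest
    ... | no x≉y | here x≈y = ⊥-elim (x≉y x≈y)
    ... | no _ | there x∈ys = x∈ys ∷ others xs rest

  count-partition : ∀ {d p} {D : Set d} {P : Pred D p} (P? : Decidable P) (g : D → A) (xs : List D) →
    ∀ ts → Unique S ts → (∀ {x} → P x → g x ∈ ts) →
    count P? xs ≡ sum (map (λ t → count (λ x → P? x ×-dec (g x ≟ t)) xs) ts)
  count-partition P? g xs [] _ P⇒g∈ = count-¬Any P? {xs} (λ any → case P⇒g∈ (proj₂ (satisfied any)) of λ ())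
  count-partition {P = P} P? g xs (t ∷ ts) (t∉ts ∷ ts!) P⇒g∈ = begin
    count P? xs
      ≡⟨ count-split P? (λ x → g x ≟ t) xs ⟩
    count (λ x → P? x ×-dec (g x ≟ t)) xs + count (λ x → P? x ×-dec ¬? (g x ≟ t)) xs
      ≡⟨ ≡.cong (_ +_) (count-partition _ g xs ts ts! P∧≉t⇒g∈ts) ⟩
    count (λ x → P? x ×-dec (g x ≟ t)) xs + sum (map (λ t′ → count (λ x → (P? x ×-dec ¬? (g x ≟ t)) ×-dec (g x ≟ t′)) xs) ts)
      ≡⟨ ≡.cong (_ +_) (sum-cong (drop-≉t ts t∉ts)) ⟩
    count (λ x → P? x ×-dec (g x ≟ t)) xs + sum (map (λ t′ → count (λ x → P? x ×-dec (g x ≟ t′)) xs) ts) ∎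
    where
    open ≡.≡-Reasoning
    P∧≉t⇒g∈ts : ∀ {x} → P x × ¬ g x ≈ t → g x ∈ ts
    P∧≉t⇒g∈ts (px , gx≉t) with P⇒g∈ px
    ... | here gx≈t = ⊥-elim (gx≉t gx≈t)
    ... | there gx∈ts = gx∈ts
    drop-≉t : ∀ ts → All (λ t′ → ¬ t ≈ t′) ts →
      All (λ t′ → count (λ x → (P? x ×-dec ¬? (g x ≟ t)) ×-dec (g x ≟ t′)) xs
                ≡ count (λ x → P? x ×-dec (g x ≟ t′)) xs) ts
    drop-≉t [] [] = []
    drop-≉t (t′ ∷ ts) (t≉t′ ∷ rest) =
      count-cong _ _ ((λ ((px , _) , gx≈t′) → px , gx≈t′)
                     , (λ (px , gx≈t′) → (px , λ gx≈t → t≉t′ (trans (sym gx≈t) gx≈t′)) , gx≈t′)) xs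
      ∷ drop-≉t ts rest

  module _ {b ℓ′} (D : Setoid b ℓ′) {p q} {P : Pred (Setoid.Carrier D) p} {R : Pred A q}
           (P? : Decidable P) (R? : Decidable R) where
    open Setoid D using () renaming (_≈_ to _≈ᴰ_)

    count-≤-injection : ∀ {xs ys} → Unique D xs → (∀ y → y ∈ ys) → R Respects _≈_ →
      (f : Setoid.Carrier D → A) → (∀ {x} → P x → R (f x)) →
      (∀ {x x′} → P x → P x′ → f x ≈ f x′ → x ≈ᴰ x′) →
      count P? xs ≤ count R? ys
    count-≤-injection {xs} {ys} xs! ys-complete resp f f-maps f-inj =
      ≤-trans (≤-reflexive (≡.sym (length-map f (filter P? xs))))
        (unique-⊆⇒length-≤ (filter R? ys) (image-unique (filter P? xs) (Unique.filter⁺ D P? xs!) (all-filter P? xs))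
          (All.map⁺ (All.map (λ px → ∈-filter⁺ S R? resp (ys-complete _) (f-maps px)) (all-filter P? xs))))
      where
      image-unique : ∀ zs → Unique D zs → All P zs → Unique S (map f zs)
      image-unique [] _ _ = []
      image-unique (z ∷ zs) (z∉zs ∷ zs!) (pz ∷ pzs) = All.map⁺ (distinct zs z∉zs pzs) ∷ image-unique zs zs! pzs
        where
        distinct : ∀ zs → All (λ z′ → ¬ z ≈ᴰ z′) zs → All P zs → All (λ z′ → ¬ f z ≈ f z′) zs
        distinct [] [] [] = []
        distinct (z′ ∷ zs) (z≉z′ ∷ rest) (pz′ ∷ pzs) = (λ fz≈fz′ → z≉z′ (f-inj pz pz′ fz≈fz′)) ∷ distinct zs rest pzs

module BijectiveCounting {a ℓa b ℓb} (S : Setoid a ℓa) (T : Setoid b ℓb)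
  (_≟S_ : Binary.Decidable (Setoid._≈_ S)) (_≟T_ : Binary.Decidable (Setoid._≈_ T)) where

  open import Data.Nat.Properties using (≤-antisym)
  open import Data.List.Membership.Setoid S using () renaming (_∈_ to _∈S_)
  open import Data.List.Membership.Setoid T using () renaming (_∈_ to _∈T_)
  open import Data.List.Relation.Unary.Unique.Setoid using (Unique)
  open import Relation.Unary using (Pred; Decidable)
  open import Relation.Binary.PropositionalEquality using (_≡_)
  open Counting
  open import Relation.Binary.Definitions using (_Respects_)
  open SetoidCounting S _≟S_ using () renaming (count-≤-injection to count-≤-injectionS)
  open SetoidCounting T _≟T_ using () renaming (count-≤-injection to count-≤-injectionT)

  open Setoid S using () renaming (Carrier to A; _≈_ to _≈S_; sym to symS; trans to transS)
  open Setoid T using () renaming (Carrier to B; _≈_ to _≈T_; sym to symT; trans to transT)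

  count-bijection : ∀ {p q} {P : Pred A p} {R : Pred B q} (P? : Decidable P) (R? : Decidable R) →
    ∀ {xs ys} → Unique S xs → Unique T ys → (∀ x → x ∈S xs) → (∀ y → y ∈T ys) →
    P Respects _≈S_ → R Respects _≈T_ →
    (f : A → B) (g : B → A) → (∀ {x x′} → x ≈S x′ → f x ≈T f x′) → (∀ {y y′} → y ≈T y′ → g y ≈S g y′) →
    (∀ {x} → P x → R (f x)) → (∀ {y} → R y → P (g y)) →
    (∀ {x} → P x → g (f x) ≈S x) → (∀ {y} → R y → f (g y) ≈T y) →
    count P? xs ≡ count R? ys
  count-bijection P? R? xs! ys! xs-complete ys-complete P-resp R-resp f g f-cong g-cong f-maps g-maps g∘f f∘g =
    ≤-antisym
      (count-≤-injectionT S P? R? xs! ys-complete R-resp f f-maps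
         (λ px px′ fx≈fx′ → transS (symS (g∘f px)) (transS (g-cong fx≈fx′) (g∘f px′))))
      (count-≤-injectionS T R? P? ys! xs-complete P-resp g g-maps
         (λ ry ry′ gy≈gy′ → transT (symT (f∘g ry)) (transT (f-cong gy≈gy′) (f∘g ry′))))

module CommutativeMonoidProduct {c ℓ} (M : CommutativeMonoid c ℓ) where

  open import Data.Nat using (suc; _≤_)
  open import Data.Nat.Properties using (≤-pred)
  open import Data.List using (List; []; _∷_; length; foldr)
  open import Data.List.Properties using (length-removeAt′)
  open import Data.List.Relation.Unary.Any as Any using (here; there; _─_)
  open import Data.List.Relation.Unary.Any.Properties using (lookup-result)
  open import Data.List.Relation.Unary.All using (All; []; _∷_)
  import Data.List.Relation.Unary.All.Properties as All
  open import Data.List.Relation.Unary.AllPairs using ([]; _∷_)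
  open import Relation.Nullary using (¬_; contradiction)
  import Relation.Binary.PropositionalEquality as ≡

  open CommutativeMonoid M
  open import Data.List.Membership.Setoid setoid using (_∈_)
  open import Data.List.Relation.Unary.Unique.Setoid setoid using (Unique)
  open import Algebra.Properties.CommutativeSemigroup commutativeSemigroup using (x∙yz≈y∙xz)
  open import Relation.Binary.Reasoning.Setoid setoid

  ∏ : List Carrier → Carrier
  ∏ = foldr _∙_ ε

  ∏-─ : ∀ {x ws} (x∈ws : x ∈ ws) → ∏ ws ≈ Any.lookup x∈ws ∙ ∏ (ws ─ x∈ws)
  ∏-─ (here _) = refl
  ∏-─ {ws = w ∷ ws} (there x∈ws) = begin
    w ∙ ∏ ws                                          ≈⟨ ∙-congˡ (∏-─ x∈ws) ⟩
    w ∙ (Any.lookup x∈ws ∙ ∏ (ws ─ x∈ws))             ≈⟨ x∙yz≈y∙xz _ _ _ ⟩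
    Any.lookup x∈ws ∙ (w ∙ ∏ (ws ─ x∈ws))             ∎

  ∈-─ : ∀ {x y ws} (x∈ws : x ∈ ws) → y ∈ ws → ¬ y ≈ Any.lookup x∈ws → y ∈ (ws ─ x∈ws)
  ∈-─ (here _) (here y≈w) y≉w = contradiction y≈w y≉w
  ∈-─ (here _) (there y∈ws) _ = y∈ws
  ∈-─ (there _) (here y≈w) _ = here y≈w
  ∈-─ (there x∈ws) (there y∈ws) y≉ = there (∈-─ x∈ws y∈ws y≉)

  Unique-─ : ∀ {x ws} (x∈ws : x ∈ ws) → Unique ws → Unique (ws ─ x∈ws)
  Unique-─ (here _) (_ ∷ ws!) = ws!
  Unique-─ (there x∈ws) (w∉ws ∷ ws!) = All.─⁺ x∈ws w∉ws ∷ Unique-─ x∈ws ws!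

  ∏-unique-⊆ : ∀ {zs ws} → Unique zs → Unique ws → All (_∈ ws) zs → length ws ≤ length zs → ∏ zs ≈ ∏ ws
  ∏-unique-⊆ {[]} {[]} _ _ _ _ = refl
  ∏-unique-⊆ {z ∷ zs} {ws} (z∉zs ∷ zs!) ws! (z∈ws ∷ zs⊆ws) |ws|≤ = begin
    z ∙ ∏ zs                             ≈⟨ ∙-cong (lookup-result z∈ws) ∏zs≈∏[ws─z] ⟩
    Any.lookup z∈ws ∙ ∏ (ws ─ z∈ws)      ≈⟨ ∏-─ z∈ws ⟨
    ∏ ws                                 ∎
    where
    |ws─z|≤ : length (ws ─ z∈ws) ≤ length zs
    |ws─z|≤ = ≤-pred (≡.subst (_≤ suc (length zs)) (length-removeAt′ ws (Any.index z∈ws)) |ws|≤)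
    shrink : ∀ {zs} → All (λ z′ → ¬ z ≈ z′) zs → All (_∈ ws) zs → All (_∈ (ws ─ z∈ws)) zs
    shrink [] [] = []
    shrink (z≉z′ ∷ rest) (z′∈ws ∷ zs⊆ws) =
      ∈-─ z∈ws z′∈ws (λ z′≈ → z≉z′ (trans (lookup-result z∈ws) (sym z′≈))) ∷ shrink rest zs⊆ws
    ∏zs≈∏[ws─z] : ∏ zs ≈ ∏ (ws ─ z∈ws)
    ∏zs≈∏[ws─z] = ∏-unique-⊆ zs! (Unique-─ z∈ws ws!) (shrink z∉zs zs⊆ws) |ws─z|≤

-- Ring normalisation with coefficients in 𝔽₂ = (Bool, xor, ∧), so that 1 + 1 = 0 is built in.
module Characteristic2 {c ℓ} (R : CommutativeRing c ℓ) where

  open import Data.Bool using (Bool; true; false; _xor_; _∧_)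
  import Data.Bool as Bool
  import Data.Maybe as Maybe
  open import Relation.Nullary.Decidable using (dec⇒maybe)
  open import Function using (id)
  open import Relation.Binary.Definitions using (WeaklyDecidable)
  open import Algebra.Bundles.Raw using (RawRing)
  open import Algebra.Solver.Ring.AlmostCommutativeRing
    using (fromCommutativeRing; _-Raw-AlmostCommutative⟶_; Induced-equivalence)

  open CommutativeRing R
  open import Algebra.Properties.Ring ring using (-0#≈0#; +-inverseˡ-unique)

  𝔽₂ : RawRing _ _
  𝔽₂ = record
    { Carrier = Bool ; _≈_ = _≡_ ; _+_ = _xor_ ; _*_ = _∧_
    ; -_ = id ; 0# = false ; 1# = true }

  module Solver (char2 : 1# + 1# ≈ 0#) where

    ι : Bool → Carrier
    ι false = 0#
    ι true  = 1#

    ι-homo : 𝔽₂ -Raw-AlmostCommutative⟶ fromCommutativeRing R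
    ι-homo = record
      { ⟦_⟧ = ι
      ; +-homo = +-homo
      ; *-homo = *-homo
      ; -‿homo = -‿homo
      ; 0-homo = refl
      ; 1-homo = refl
      }
      where
      +-homo : ∀ a b → ι (a xor b) ≈ ι a + ι b
      +-homo false b = sym (+-identityˡ _)
      +-homo true false = sym (+-identityʳ _)
      +-homo true true = sym char2
      *-homo : ∀ a b → ι (a ∧ b) ≈ ι a * ι b
      *-homo false b = sym (zeroˡ _)
      *-homo true b = sym (*-identityˡ _)
      -‿homo : ∀ a → ι a ≈ - ι a
      -‿homo false = sym -0#≈0#
      -‿homo true = +-inverseˡ-unique 1# 1# char2

    coefficient≟ : WeaklyDecidable (Induced-equivalence ι-homo)
    coefficient≟ a b = Maybe.map ≡⇒ι≈ (dec⇒maybe (a Bool.≟ b))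
      where
      ≡⇒ι≈ : a ≡ b → ι a ≈ ι b
      ≡⇒ι≈ ≡.refl = refl

    open import Algebra.Solver.Ring 𝔽₂ (fromCommutativeRing R) ι-homo coefficient≟ public

module FiniteFieldOfCharacteristic2 {c ℓ : Level} {m : ℕ} (F : FiniteField2 c ℓ m) where

  open import Level using (_⊔_)

  open import Data.Nat as ℕ using (zero; suc; _≤_)
  import Data.Nat.Properties as ℕ
  open import Data.Bool using (false; true)
  open import Data.List using (List; []; _∷_; length; filter; map)
  open import Data.List.Properties using (length-map)
  open import Data.Nat.ListAction using (sum)
  open import Data.List.Relation.Unary.All as All using (All; []; _∷_; lookupₛ)
  open import Data.List.Relation.Unary.Any using (here; there; any?; satisfied)
  import Data.List.Relation.Unary.All.Properties as All
  open import Data.List.Membership.Setoid.Properties using (∈-filter⁺)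
  open import Relation.Nullary using (¬_; Dec; yes; no)
  open import Data.Product using (Σ; _×_; _,_)
  open import Data.Sum using (_⊎_; inj₁; inj₂)
  open import Data.Empty using (⊥-elim)
  open import Relation.Nullary.Decidable using (¬?)
  open import Relation.Unary using (Pred; Decidable)
  open import Relation.Binary.PropositionalEquality as ≡ using (_≡_; _≢_)
  import Data.List.Relation.Unary.Unique.Setoid.Properties as Unique
  open Counting

  open FiniteField2 F
  open Characteristic2.Solver cring char2 using (solve; _:=_; _:+_; _:*_; con)
  open import Relation.Binary.Reasoning.Setoid setoid
  open import Data.List.Relation.Unary.Unique.Setoid setoid using (Unique)
  open import Data.List.Membership.Setoid setoid using (_∈_)
  open import Relation.Binary.Definitions using (_Respects_)
  open SetoidCounting setoid _≟_ using (count-≡1; count-≤1)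
  open BijectiveCounting setoid setoid _≟_ _≟_ using (count-bijection)
  open CommutativeMonoidProduct *-commutativeMonoid using (∏; ∏-unique-⊆)
  open import Algebra.Properties.Semiring.Exp semiring using (_^_; ^-homo-*)
  open import Algebra.Properties.CommutativeSemigroup *-commutativeSemigroup using (interchange)

  x+x≈0 : ∀ x → x + x ≈ 0#
  x+x≈0 = solve 1 (λ x → x :+ x := con false) refl

  x≈y⇒x+y≈0 : ∀ {x y} → x ≈ y → x + y ≈ 0#
  x≈y⇒x+y≈0 {y = y} x≈y = trans (+-congʳ x≈y) (x+x≈0 y)

  x+y≈0⇒x≈y : ∀ {x y} → x + y ≈ 0# → x ≈ y
  x+y≈0⇒x≈y {x} {y} x+y≈0 = begin
    x            ≈⟨ solve 2 (λ x y → x := (x :+ y) :+ y) refl x y ⟩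
    x + y + y    ≈⟨ +-congʳ x+y≈0 ⟩
    0# + y       ≈⟨ +-identityˡ y ⟩
    y            ∎

  +-cancelʳ : ∀ {x y b} → x + b ≈ y + b → x ≈ y
  +-cancelʳ {x} {y} {b} x+b≈y+b = begin
    x              ≈⟨ solve 2 (λ x b → x := x :+ b :+ b) refl x b ⟩
    x + b + b      ≈⟨ +-congʳ x+b≈y+b ⟩
    y + b + b      ≈⟨ solve 2 (λ y b → y :+ b :+ b := y) refl y b ⟩
    y              ∎

  ²-cong : ∀ {x y} → x ≈ y → x ² ≈ y ²
  ²-cong x≈y = *-cong x≈y x≈y

  ²-homo-+ : ∀ x y → (x + y) ² ≈ x ² + y ²
  ²-homo-+ = solve 2 (λ x y → (x :+ y) :* (x :+ y) := x :* x :+ y :* y) refl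

  x*y≈0⇒y≈0 : ∀ {x y} → ¬ x ≈ 0# → x * y ≈ 0# → y ≈ 0#
  x*y≈0⇒y≈0 {x} {y} x≉0 xy≈0 = begin
    y                  ≈⟨ *-identityˡ y ⟨
    1# * y             ≈⟨ *-congʳ (trans (*-comm _ _) (inverseʳ x x≉0)) ⟨
    (x ⁻¹ * x) * y     ≈⟨ *-assoc _ _ _ ⟩
    x ⁻¹ * (x * y)     ≈⟨ *-congˡ xy≈0 ⟩
    x ⁻¹ * 0#          ≈⟨ zeroʳ _ ⟩
    0#                 ∎

  *-nonzero : ∀ {x y} → ¬ x ≈ 0# → ¬ y ≈ 0# → ¬ x * y ≈ 0#
  *-nonzero x≉0 y≉0 xy≈0 = y≉0 (x*y≈0⇒y≈0 x≉0 xy≈0)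

  *-cancelʳ : ∀ {x y z} → ¬ z ≈ 0# → x * z ≈ y * z → x ≈ y
  *-cancelʳ {x} {y} {z} z≉0 xz≈yz =
    x+y≈0⇒x≈y (x*y≈0⇒y≈0 z≉0 (trans (*-comm z _) (trans (distribʳ z x y) (x≈y⇒x+y≈0 xz≈yz))))

  ²-injective : ∀ {x y} → x ² ≈ y ² → x ≈ y
  ²-injective {x} {y} x²≈y² with (x + y) ≟ 0#
  ... | yes x+y≈0 = x+y≈0⇒x≈y x+y≈0
  ... | no x+y≉0 = x+y≈0⇒x≈y (x*y≈0⇒y≈0 x+y≉0 (trans (²-homo-+ x y) (x≈y⇒x+y≈0 x²≈y²)))

  ⁻¹-unique : ∀ {x y} → ¬ x ≈ 0# → x * y ≈ 1# → y ≈ x ⁻¹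
  ⁻¹-unique {x} {y} x≉0 xy≈1 = *-cancelʳ x≉0 (trans (*-comm y x) (trans xy≈1 (sym (trans (*-comm _ _) (inverseʳ x x≉0)))))

  ⁻¹-cong : ∀ {x y} → ¬ x ≈ 0# → x ≈ y → x ⁻¹ ≈ y ⁻¹
  ⁻¹-cong {x} {y} x≉0 x≈y = sym (⁻¹-unique x≉0 (trans (*-congʳ x≈y) (inverseʳ y (λ y≈0 → x≉0 (trans x≈y y≈0)))))

  ⁻¹-nonzero : ∀ {x} → ¬ x ≈ 0# → ¬ x ⁻¹ ≈ 0#
  ⁻¹-nonzero {x} x≉0 x⁻¹≈0 = 1≉0 (trans (sym (inverseʳ x x≉0)) (trans (*-congˡ x⁻¹≈0) (zeroʳ x)))

  -- Fermat's little theorem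

  nonzeros : List Carrier
  nonzeros = filter (λ x → ¬? (x ≟ 0#)) elems

  length-elems : length elems ≡ suc (length nonzeros)
  length-elems = ≡.trans (≡.sym (count-+-count-¬ (_≟ 0#) elems)) (≡.cong (ℕ._+ length nonzeros) one-zero)
    where
    one-zero : count (_≟ 0#) elems ≡ 1
    one-zero = count-≡1 (_≟ 0#) (λ x≈y x≈0 → trans (sym x≈y) x≈0) unique 0# (complete 0#) refl (λ x≈0 → x≈0)

  ∏-map-* : ∀ x xs → ∏ (map (x *_) xs) ≈ x ^ length xs * ∏ xs
  ∏-map-* x [] = sym (*-identityˡ 1#)
  ∏-map-* x (y ∷ xs) = trans (*-congˡ (∏-map-* x xs)) (interchange x y _ _)

  ∏-nonzero : ∀ {xs} → All (λ x → ¬ x ≈ 0#) xs → ¬ ∏ xs ≈ 0#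
  ∏-nonzero [] = 1≉0
  ∏-nonzero (x≉0 ∷ xs≉0) = *-nonzero x≉0 (∏-nonzero xs≉0)

  -- Multiplication by x ≠ 0 permutes the nonzero elements, so it fixes their product.
  x^|nonzeros|≈1 : ∀ {x} → ¬ x ≈ 0# → x ^ length nonzeros ≈ 1#
  x^|nonzeros|≈1 {x} x≉0 = *-cancelʳ (∏-nonzero (All.all-filter nonzero? elems)) (begin
    x ^ length nonzeros * ∏ nonzeros   ≈⟨ ∏-map-* x nonzeros ⟨
    ∏ (map (x *_) nonzeros)            ≈⟨ ∏-unique-⊆ x*-unique nonzeros-unique x*-⊆
                                            (ℕ.≤-reflexive (≡.sym (length-map (x *_) nonzeros))) ⟩
    ∏ nonzeros                         ≈⟨ *-identityˡ _ ⟨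
    1# * ∏ nonzeros                    ∎)
    where
    nonzero? : ∀ y → Dec (¬ y ≈ 0#)
    nonzero? y = ¬? (y ≟ 0#)
    nonzeros-unique : Unique nonzeros
    nonzeros-unique = Unique.filter⁺ setoid nonzero? unique
    x*-unique : Unique (map (x *_) nonzeros)
    x*-unique = Unique.map⁺ setoid setoid
      (λ {y} {z} xy≈xz → *-cancelʳ x≉0 (trans (*-comm y x) (trans xy≈xz (*-comm x z)))) nonzeros-unique
    x*-⊆ : All (_∈ nonzeros) (map (x *_) nonzeros)
    x*-⊆ = All.map⁺ (All.map (λ y≉0 → ∈-filter⁺ setoid nonzero? (λ y≈z y≉0 z≈0 → y≉0 (trans y≈z z≈0))
                                          (complete _) (*-nonzero x≉0 y≉0))
                             (All.all-filter nonzero? elems))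

  sqIter≈^ : ∀ i x → sqIter i x ≈ x ^ (2 ℕ.^ i)
  sqIter≈^ zero x = sym (*-identityʳ x)
  sqIter≈^ (suc i) x = begin
    sqIter i x * sqIter i x                ≈⟨ *-cong (sqIter≈^ i x) (sqIter≈^ i x) ⟩
    x ^ (2 ℕ.^ i) * x ^ (2 ℕ.^ i)          ≈⟨ ^-homo-* x (2 ℕ.^ i) (2 ℕ.^ i) ⟨
    x ^ (2 ℕ.^ i ℕ.+ 2 ℕ.^ i)              ≡⟨ ≡.cong (λ k → x ^ (2 ℕ.^ i ℕ.+ k)) (ℕ.+-identityʳ (2 ℕ.^ i)) ⟨
    x ^ (2 ℕ.^ suc i)                      ∎

  fermat : ∀ x → sqIter m x ≈ x
  fermat x = begin
    sqIter m x                   ≈⟨ sqIter≈^ m x ⟩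
    x ^ (2 ℕ.^ m)                ≡⟨ ≡.cong (x ^_) (≡.trans (≡.sym card) length-elems) ⟩
    x * x ^ length nonzeros      ≈⟨ x*x^|nonzeros|≈x (x ≟ 0#) ⟩
    x                            ∎
    where
    x*x^|nonzeros|≈x : Dec (x ≈ 0#) → x * x ^ length nonzeros ≈ x
    x*x^|nonzeros|≈x (yes x≈0) = trans (*-congʳ x≈0) (trans (zeroˡ _) (sym x≈0))
    x*x^|nonzeros|≈x (no x≉0) = trans (*-congˡ (x^|nonzeros|≈1 x≉0)) (*-identityʳ x)

  m-nonzero : Σ ℕ λ j → m ≡ suc j
  m-nonzero = nonzero-exponent m card
    where
    1∈nonzeros : 1# ∈ nonzeros
    1∈nonzeros = ∈-filter⁺ setoid (λ y → ¬? (y ≟ 0#)) (λ x≈y x≉0 y≈0 → x≉0 (trans x≈y y≈0)) (complete 1#) 1≉0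
    nonempty : ∀ {xs} → 1# ∈ xs → length xs ≢ 0
    nonempty (here _) ()
    nonempty (there _) ()
    nonzero-exponent : ∀ n → length elems ≡ 2 ℕ.^ n → Σ ℕ λ j → n ≡ suc j
    nonzero-exponent (suc j) _ = j , ≡.refl
    nonzero-exponent zero |elems|≡1 =
      ⊥-elim (nonempty 1∈nonzeros (ℕ.suc-injective (≡.trans (≡.sym length-elems) |elems|≡1)))

  √-exists : ∀ x → Σ Carrier λ r → r ² ≈ x
  √-exists x with m-nonzero
  ... | j , m≡suc-j = sqIter j x , ≡.subst (λ n → sqIter n x ≈ x) m≡suc-j (fermat x)

  sqIter-cong : ∀ i {x y} → x ≈ y → sqIter i x ≈ sqIter i y
  sqIter-cong zero x≈y = x≈y
  sqIter-cong (suc i) x≈y = ²-cong (sqIter-cong i x≈y)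

  sqIter-homo-+ : ∀ i x y → sqIter i (x + y) ≈ sqIter i x + sqIter i y
  sqIter-homo-+ zero x y = refl
  sqIter-homo-+ (suc i) x y = trans (²-cong (sqIter-homo-+ i x y)) (²-homo-+ _ _)

  sqIter-² : ∀ i x → sqIter i (x ²) ≡ sqIter (suc i) x
  sqIter-² zero x = ≡.refl
  sqIter-² (suc i) x = ≡.cong _² (sqIter-² i x)

  trAux-cong : ∀ j {x y} → x ≈ y → trAux j x ≈ trAux j y
  trAux-cong zero x≈y = refl
  trAux-cong (suc j) x≈y = +-cong (trAux-cong j x≈y) (sqIter-cong j x≈y)

  trAux-homo-+ : ∀ j x y → trAux j (x + y) ≈ trAux j x + trAux j y
  trAux-homo-+ zero x y = sym (+-identityʳ 0#)
  trAux-homo-+ (suc j) x y =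
    trans (+-cong (trAux-homo-+ j x y) (sqIter-homo-+ j x y)) (+-interchange _ _ _ _)
    where open import Algebra.Properties.CommutativeSemigroup +-commutativeSemigroup using () renaming (interchange to +-interchange)

  Tr-cong : ∀ {x y} → x ≈ y → Tr x ≈ Tr y
  Tr-cong = trAux-cong m

  Tr-homo-+ : ∀ x y → Tr (x + y) ≈ Tr x + Tr y
  Tr-homo-+ = trAux-homo-+ m

  -- The partial traces of w² + w telescope.
  trAux-℘ : ∀ j w → trAux j (w ² + w) ≈ sqIter j w + w
  trAux-℘ zero w = sym (x+x≈0 w)
  trAux-℘ (suc j) w = begin
    trAux j (w ² + w) + sqIter j (w ² + w)                 ≈⟨ +-cong (trAux-℘ j w) (sqIter-homo-+ j (w ²) w) ⟩
    (sqIter j w + w) + (sqIter j (w ²) + sqIter j w)       ≡⟨ ≡.cong (λ t → (sqIter j w + w) + (t + sqIter j w)) (sqIter-² j w) ⟩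
    (sqIter j w + w) + (sqIter (suc j) w + sqIter j w)     ≈⟨ solve 3 (λ a w b → (a :+ w) :+ (b :+ a) := b :+ w) refl _ _ _ ⟩
    sqIter (suc j) w + w                                   ∎

  Tr-℘ : ∀ w → Tr (w ² + w) ≈ 0#
  Tr-℘ w = trans (trAux-℘ m w) (x≈y⇒x+y≈0 (fermat w))

  -- Roots of polynomial functions

  -- Horner form; the innermost constant is the leading coefficient, hence nonzero.
  data PolyOfDegree : ℕ → (Carrier → Carrier) → Set (c ⊔ ℓ) where
    const : ∀ {f} k → ¬ k ≈ 0# → (∀ x → f x ≈ k) → PolyOfDegree 0 f
    x*g+k : ∀ {n f g} → PolyOfDegree n g → ∀ k → (∀ x → f x ≈ x * g x + k) → PolyOfDegree (suc n) f

  +-lower : ∀ {n g h} → PolyOfDegree (suc n) g → PolyOfDegree n h → ∀ a → PolyOfDegree (suc n) (λ x → g x + a * h x)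
  +-lower (x*g+k pg k eg) (const d _ eh) a =
    x*g+k pg (k + a * d) (λ x → trans (+-cong (eg x) (*-congˡ (eh x))) (+-assoc _ _ _))
  +-lower (x*g+k pg k eg) (x*g+k ph e eh) a =
    x*g+k (+-lower pg ph a) (k + a * e) (λ x → trans (+-cong (eg x) (*-congˡ (eh x)))
      (solve 6 (λ x G k a H e → x :* G :+ k :+ a :* (x :* H :+ e) := x :* (G :+ a :* H) :+ (k :+ a :* e)) refl x _ k a _ e))

  divide-linear : ∀ {n f} → PolyOfDegree (suc n) f → ∀ r →
    Σ (Carrier → Carrier) λ h → PolyOfDegree n h × (∀ x → f x ≈ (x + r) * h x + f r)
  divide-linear {f = f} (x*g+k {g = g} pg k f≈) r with pg
  ... | const d d≉0 g≈d = g , pg , λ x → begin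
    f x                              ≈⟨ f≈ x ⟩
    x * g x + k                      ≈⟨ shift x (g x) ⟩
    (x + r) * g x + (r * g x + k)    ≈⟨ +-congˡ (+-congʳ (*-congˡ (trans (g≈d x) (sym (g≈d r))))) ⟩
    (x + r) * g x + (r * g r + k)    ≈⟨ +-congˡ (f≈ r) ⟨
    (x + r) * g x + f r              ∎
    where
    shift : ∀ x G → x * G + k ≈ (x + r) * G + (r * G + k)
    shift x G = solve 4 (λ x G k r → x :* G :+ k := (x :+ r) :* G :+ (r :* G :+ k)) refl x G k r
  ... | pg@(x*g+k _ _ _) with divide-linear pg r
  ...   | q , pq , g≈ = (λ x → g x + r * q x) , +-lower pg pq r , λ x → begin
    f x                                            ≈⟨ f≈ x ⟩
    x * g x + k                                    ≈⟨ +-congʳ (*-congˡ (g≈ x)) ⟩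
    x * ((x + r) * q x + g r) + k                  ≈⟨ regroup x (q x) ⟩
    (x + r) * ((x + r) * q x + g r + r * q x) + (r * g r + k)
                                                   ≈⟨ +-cong (*-congˡ (+-congʳ (g≈ x))) (f≈ r) ⟨
    (x + r) * (g x + r * q x) + f r                ∎
    where
    regroup : ∀ x Q → x * ((x + r) * Q + g r) + k ≈ (x + r) * ((x + r) * Q + g r + r * Q) + (r * g r + k)
    regroup x Q = solve 5 (λ x Q G k r → x :* ((x :+ r) :* Q :+ G) :+ k := (x :+ r) :* ((x :+ r) :* Q :+ G :+ r :* Q) :+ (r :* G :+ k))
                    refl x Q (g r) k r

  square : ∀ {n g} → PolyOfDegree n g → PolyOfDegree (n ℕ.+ n) (λ x → g x ²)
  square (const k k≉0 g≈k) = const (k ²) (*-nonzero k≉0 k≉0) (λ x → ²-cong (g≈k x))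
  square {suc n} {g} (x*g+k pg k g≈) =
    ≡.subst (λ d → PolyOfDegree d (λ x → g x ²)) (≡.cong suc (≡.sym (ℕ.+-suc n n)))
      (x*g+k (x*g+k (square pg) 0# (λ _ → sym (+-identityʳ _))) (k ²)
        (λ x → trans (²-cong (g≈ x)) (solve 3 (λ x G k → (x :* G :+ k) :* (x :* G :+ k) := x :* (x :* (G :* G)) :+ k :* k) refl x _ k)))

  roots≤degree : ∀ {n f} → PolyOfDegree n f → ∀ {xs} → Unique xs → count (λ x → f x ≟ 0#) xs ≤ n
  roots≤degree (const k k≉0 f≈k) {xs} _ =
    ℕ.≤-reflexive (count-¬Any (λ x → _ ≟ 0#) {xs} (λ some → let (x , fx≈0) = satisfied some in k≉0 (trans (sym (f≈k x)) fx≈0)))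
  roots≤degree {suc n} {f} pf {xs} xs! with any? (λ x → f x ≟ 0#) xs
  ... | no no-root = ℕ.≤-trans (ℕ.≤-reflexive (count-¬Any (λ x → f x ≟ 0#) no-root)) ℕ.z≤n
  ... | yes some with satisfied some
  ...   | r , fr≈0 with divide-linear pf r
  ...     | q , pq , f≈ = ℕ.≤-trans (count-≤-+ (λ x → f x ≟ 0#) (_≟ r) (λ x → q x ≟ 0#) root-of-factor xs)
                            (ℕ.+-mono-≤ (count-≤1 (_≟ r) (λ x≈r y≈r → trans x≈r (sym y≈r)) xs!) (roots≤degree pq xs!))
    where
    root-of-factor : ∀ {x} → f x ≈ 0# → x ≈ r ⊎ q x ≈ 0#
    root-of-factor {x} fx≈0 with (x + r) ≟ 0#
    ... | yes x+r≈0 = inj₁ (x+y≈0⇒x≈y x+r≈0)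
    ... | no x+r≉0 = inj₂ (x*y≈0⇒y≈0 x+r≉0 (begin
      (x + r) * q x             ≈⟨ +-identityʳ _ ⟨
      (x + r) * q x + 0#        ≈⟨ +-congˡ fr≈0 ⟨
      (x + r) * q x + f r       ≈⟨ f≈ x ⟨
      f x                       ≈⟨ fx≈0 ⟩
      0#                        ∎))

  -- The Artin–Schreier equation z² + z = k

  traceQuotient : ℕ → Carrier → Carrier
  traceQuotient zero x = 1#
  traceQuotient (suc j) x = x * traceQuotient j x ² + 1#

  quotientDegree : ℕ → ℕ
  quotientDegree zero = 0
  quotientDegree (suc j) = suc (quotientDegree j ℕ.+ quotientDegree j)

  traceQuotient-degree : ∀ j → PolyOfDegree (quotientDegree j) (traceQuotient j)
  traceQuotient-degree zero = const 1# 1≉0 (λ _ → refl)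
  traceQuotient-degree (suc j) = x*g+k (square (traceQuotient-degree j)) 1# (λ _ → refl)

  suc-quotientDegree : ∀ j → suc (quotientDegree j) ≡ 2 ℕ.^ j
  suc-quotientDegree zero = ≡.refl
  suc-quotientDegree (suc j) =
    ≡.trans (≡.cong suc (≡.sym (ℕ.+-suc (quotientDegree j) (quotientDegree j))))
      (≡.cong₂ ℕ._+_ (suc-quotientDegree j) (≡.trans (suc-quotientDegree j) (≡.sym (ℕ.+-identityʳ _))))

  trAux-suc : ∀ j x → trAux (suc j) x ≈ x + trAux j x ²
  trAux-suc zero x = solve 1 (λ x → con false :+ x := x :+ con false :* con false) refl x
  trAux-suc (suc j) x = begin
    trAux (suc j) x + sqIter j x ²                ≈⟨ +-congʳ (trAux-suc j x) ⟩
    (x + trAux j x ²) + sqIter j x ²              ≈⟨ solve 3 (λ x T S → (x :+ T :* T) :+ S :* S := x :+ (T :+ S) :* (T :+ S)) refl x _ _ ⟩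
    x + (trAux j x + sqIter j x) ²                ∎

  trAux-suc≈x*traceQuotient : ∀ j x → trAux (suc j) x ≈ x * traceQuotient j x
  trAux-suc≈x*traceQuotient zero x = solve 1 (λ x → con false :+ x := x :* con true) refl x
  trAux-suc≈x*traceQuotient (suc j) x = begin
    trAux (suc (suc j)) x                       ≈⟨ trAux-suc (suc j) x ⟩
    x + trAux (suc j) x ²                       ≈⟨ +-congˡ (²-cong (trAux-suc≈x*traceQuotient j x)) ⟩
    x + (x * traceQuotient j x) ²               ≈⟨ solve 2 (λ x R → x :+ (x :* R) :* (x :* R) := x :* (x :* (R :* R) :+ con true)) refl x _ ⟩
    x * traceQuotient (suc j) x                 ∎

  Tr≈0? : ∀ x → Dec (Tr x ≈ 0#)
  Tr≈0? x = Tr x ≟ 0#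

  2*|ker-Tr|≤|F| : 2 ℕ.* count Tr≈0? elems ≤ length elems
  2*|ker-Tr|≤|F| with m-nonzero
  ... | j , m≡suc-j =
    ℕ.≤-trans (ℕ.*-monoʳ-≤ 2 (≡.subst (λ n → count (λ x → trAux n x ≟ 0#) elems ≤ 2 ℕ.^ j) (≡.sym m≡suc-j) roots))
              (ℕ.≤-reflexive (≡.sym (≡.trans card (≡.cong (2 ℕ.^_) m≡suc-j))))
    where
    trace-degree : PolyOfDegree (suc (quotientDegree j)) (trAux (suc j))
    trace-degree = x*g+k (traceQuotient-degree j) 0# (λ x → trans (trAux-suc≈x*traceQuotient j x) (sym (+-identityʳ _)))
    roots : count (λ x → trAux (suc j) x ≟ 0#) elems ≤ 2 ℕ.^ j
    roots = ℕ.≤-trans (roots≤degree trace-degree unique) (ℕ.≤-reflexive (suc-quotientDegree j))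

  inT-cong-Tr : ∀ e {x y} → Tr x ≈ Tr y → inT e x ≡ inT e y
  inT-cong-Tr e {x} {y} Trx≈Try with Tr x ≟ ⟦ e ⟧ | Tr y ≟ ⟦ e ⟧
  ... | yes _ | yes _ = ≡.refl
  ... | no _ | no _ = ≡.refl
  ... | yes Trx≈e | no Try≉e = ⊥-elim (Try≉e (trans (sym Trx≈Try) Trx≈e))
  ... | no Trx≉e | yes Try≈e = ⊥-elim (Trx≉e (trans Trx≈Try Try≈e))

  inT-cong : ∀ e {x y} → x ≈ y → inT e x ≡ inT e y
  inT-cong e x≈y = inT-cong-Tr e (Tr-cong x≈y)

  count-Tr≈0 : ∀ xs → count Tr≈0? xs ≡ sum (map (inT false) xs)
  count-Tr≈0 [] = ≡.refl
  count-Tr≈0 (x ∷ xs) with Tr x ≟ 0#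
  ... | yes _ = ≡.cong suc (count-Tr≈0 xs)
  ... | no _ = count-Tr≈0 xs

  ℘-cong : ∀ {x y} → x ≈ y → x ² + x ≈ y ² + y
  ℘-cong x≈y = +-cong (²-cong x≈y) x≈y

  ℘-root? : ∀ k z → Dec (z ² + z ≈ k)
  ℘-root? k z = (z ² + z) ≟ k

  rootsOf-cong : ∀ {k k′} → k ≈ k′ → length (rootsOf k) ≡ length (rootsOf k′)
  rootsOf-cong k≈k′ =
    count-cong (℘-root? _) (℘-root? _) ((λ ℘z≈k → trans ℘z≈k k≈k′) , (λ ℘z≈k′ → trans ℘z≈k′ (sym k≈k′))) elems

  |rootsOf|≤2 : ∀ k → length (rootsOf k) ≤ 2
  |rootsOf|≤2 k = ℕ.≤-trans (ℕ.≤-reflexive (count-cong (℘-root? k) (λ z → (z ² + z + k) ≟ 0#) (x≈y⇒x+y≈0 , x+y≈0⇒x≈y) elems))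
                            (roots≤degree ℘+k-degree unique)
    where
    ℘+k-degree : PolyOfDegree 2 (λ z → z ² + z + k)
    ℘+k-degree = x*g+k (x*g+k (const 1# 1≉0 (λ _ → refl)) 1# (λ _ → refl)) k
      (λ z → +-congʳ (solve 1 (λ z → z :* z :+ z := z :* (z :* con true :+ con true)) refl z))

  |rootsOf|≤2*inT : ∀ k → length (rootsOf k) ≤ 2 ℕ.* inT false k
  |rootsOf|≤2*inT k with Tr k ≟ 0#
  ... | yes _ = |rootsOf|≤2 k
  ... | no Trk≉0 = ℕ.≤-reflexive (count-¬Any (℘-root? k) {elems}
                     (λ some → let (w , ℘w≈k) = satisfied some in Trk≉0 (trans (Tr-cong (sym ℘w≈k)) (Tr-℘ w))))

  Σ|rootsOf|≡|F| : sum (map (λ k → length (rootsOf k)) elems) ≡ length elems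
  Σ|rootsOf|≡|F| = ≡.trans (count-double (λ k z → ℘-root? k z) elems elems)
                     (≡.trans (sum-cong {xs = elems} (All.tabulate (λ {z} _ → one-value z))) (sum-const-1 elems))
    where
    one-value : ∀ z → count (λ k → ℘-root? k z) elems ≡ 1
    one-value z = count-≡1 (λ k → ℘-root? k z) (λ k≈k′ ℘z≈k → trans ℘z≈k k≈k′) unique (z ² + z) (complete _) refl sym

  artin-schreier : ∀ k → length (rootsOf k) ≡ 2 ℕ.* inT false k
  artin-schreier k =
    lookupₛ setoid (λ {x} {y} x≈y |x|≡ → ≡.trans (rootsOf-cong (sym x≈y)) (≡.trans |x|≡ (≡.cong (2 ℕ.*_) (inT-cong false x≈y))))
      on-elems (complete k)
    where
    Σ2*inT≤Σ|rootsOf| : sum (map (λ k → 2 ℕ.* inT false k) elems) ≤ sum (map (λ k → length (rootsOf k)) elems)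
    Σ2*inT≤Σ|rootsOf| = ℕ.≤-trans (ℕ.≤-reflexive (≡.trans (sum-*ˡ 2 (inT false) elems) (≡.cong (2 ℕ.*_) (≡.sym (count-Tr≈0 elems)))))
                          (ℕ.≤-trans 2*|ker-Tr|≤|F| (ℕ.≤-reflexive (≡.sym Σ|rootsOf|≡|F|)))
    on-elems : All (λ k → length (rootsOf k) ≡ 2 ℕ.* inT false k) elems
    on-elems = sum-≤-sum⇒pointwise-≡ |rootsOf|≤2*inT elems Σ2*inT≤Σ|rootsOf|

  |rootsOf|-cong-Tr : ∀ {k k′} → Tr k ≈ Tr k′ → length (rootsOf k) ≡ length (rootsOf k′)
  |rootsOf|-cong-Tr {k} {k′} Trk≈Trk′ =
    ≡.trans (artin-schreier k) (≡.trans (≡.cong (2 ℕ.*_) (inT-cong-Tr false Trk≈Trk′)) (≡.sym (artin-schreier k′)))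

  module _ {p} {P : Pred Carrier p} (P? : Decidable P) (P-resp : P Respects _≈_) where

    count-scale : ∀ {λ′} → ¬ λ′ ≈ 0# → count P? elems ≡ count (λ z → P? (λ′ * z)) elems
    count-scale {λ′} λ′≉0 = count-bijection P? (λ z → P? (λ′ * z)) unique unique complete complete
      P-resp (λ z≈z′ → P-resp (*-congˡ z≈z′)) (λ′ ⁻¹ *_) (λ′ *_) *-congˡ *-congˡ
      (λ pt → P-resp (sym (λ*λ⁻¹* _)) pt) (λ pλz → pλz) (λ {t} _ → λ*λ⁻¹* t) (λ {z} _ → λ⁻¹*λ* z)
      where
      λ*λ⁻¹* : ∀ t → λ′ * (λ′ ⁻¹ * t) ≈ t
      λ*λ⁻¹* t = trans (sym (*-assoc _ _ _)) (trans (*-congʳ (inverseʳ λ′ λ′≉0)) (*-identityˡ t))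
      λ⁻¹*λ* : ∀ z → λ′ ⁻¹ * (λ′ * z) ≈ z
      λ⁻¹*λ* z = trans (sym (*-assoc _ _ _)) (trans (*-congʳ (trans (*-comm _ _) (inverseʳ λ′ λ′≉0))) (*-identityˡ z))

  quadratic : Carrier → Carrier → Carrier → Carrier → Carrier
  quadratic c τ B t = c * t ² + τ * t + B

  quadratic-cong : ∀ {c τ B t t′} → t ≈ t′ → quadratic c τ B t ≈ quadratic c τ B t′
  quadratic-cong t≈t′ = +-congʳ (+-cong (*-congˡ (²-cong t≈t′)) (*-congˡ t≈t′))

  count-quadratic : ∀ {c τ B a} → ¬ c ≈ 0# → ¬ τ ≈ 0# →
    count (λ t → quadratic c τ B t ≟ a) elems ≡ length (rootsOf (c * (τ ²) ⁻¹ * (a + B)))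
  count-quadratic {c} {τ} {B} {a} c≉0 τ≉0 =
    ≡.trans (count-scale (λ t → quadratic c τ B t ≟ a) (λ t≈t′ → trans (sym (quadratic-cong t≈t′))) λ≉0)
            (count-cong _ _ ((λ Q≈a → trans (sym (κ*[Q+B]≈℘ _)) (*-congˡ (+-congʳ Q≈a)))
                            , (λ ℘≈ → +-cancelʳ (*-cancel-κ (trans (κ*[Q+B]≈℘ _) ℘≈)))) elems)
    where
    τ²≉0 : ¬ τ ² ≈ 0#
    τ²≉0 = *-nonzero τ≉0 τ≉0
    κ : Carrier
    κ = c * (τ ²) ⁻¹
    κ≉0 : ¬ κ ≈ 0#
    κ≉0 = *-nonzero c≉0 (⁻¹-nonzero τ²≉0)
    λ≉0 : ¬ τ * c ⁻¹ ≈ 0#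
    λ≉0 = *-nonzero τ≉0 (⁻¹-nonzero c≉0)
    *-cancel-κ : ∀ {x y} → κ * x ≈ κ * y → x ≈ y
    *-cancel-κ κx≈κy = *-cancelʳ κ≉0 (trans (*-comm _ _) (trans κx≈κy (*-comm _ _)))
    κ*[Q+B]≈℘ : ∀ z → κ * (quadratic c τ B (τ * c ⁻¹ * z) + B) ≈ z ² + z
    κ*[Q+B]≈℘ z = begin
      κ * (quadratic c τ B (τ * c ⁻¹ * z) + B)
        ≈⟨ solve 6 (λ c τ B z I J → c :* J :* (c :* ((τ :* I :* z) :* (τ :* I :* z)) :+ τ :* (τ :* I :* z) :+ B :+ B)
                                := (c :* I) :* (c :* I) :* (τ :* τ :* J) :* (z :* z) :+ (c :* I) :* (τ :* τ :* J) :* z)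
                refl c τ B z (c ⁻¹) ((τ ²) ⁻¹) ⟩
      (c * c ⁻¹) * (c * c ⁻¹) * (τ ² * (τ ²) ⁻¹) * z ² + (c * c ⁻¹) * (τ ² * (τ ²) ⁻¹) * z
        ≈⟨ +-cong (*-congʳ (*-cong (*-cong cI≈1 cI≈1) τ²J≈1)) (*-congʳ (*-cong cI≈1 τ²J≈1)) ⟩
      1# * 1# * 1# * z ² + 1# * 1# * z
        ≈⟨ solve 1 (λ z → con true :* con true :* con true :* (z :* z) :+ con true :* con true :* z := z :* z :+ z) refl z ⟩
      z ² + z ∎
      where
      cI≈1 : c * c ⁻¹ ≈ 1#
      cI≈1 = inverseʳ c c≉0
      τ²J≈1 : τ ² * (τ ²) ⁻¹ ≈ 1#
      τ²J≈1 = inverseʳ (τ ²) τ²≉0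

  count-quadratic-degenerate : ∀ {c τ B a} → ¬ c ≈ 0# → τ ≈ 0# → B ≈ 0# →
    count (λ t → quadratic c τ B t ≟ a) elems ≡ 1
  count-quadratic-degenerate {c} {τ} {B} {a} c≉0 τ≈0 B≈0 with √-exists (a * c ⁻¹)
  ... | r , r²≈a/c = count-≡1 (λ t → quadratic c τ B t ≟ a) (λ t≈t′ → trans (sym (quadratic-cong t≈t′))) unique r (complete r)
    (begin
      quadratic c τ B r    ≈⟨ Q≈c*² r ⟩
      c * r ²              ≈⟨ *-congˡ r²≈a/c ⟩
      c * (a * c ⁻¹)       ≈⟨ solve 3 (λ c a I → c :* (a :* I) := a :* (c :* I)) refl c a (c ⁻¹) ⟩
      a * (c * c ⁻¹)       ≈⟨ *-congˡ (inverseʳ c c≉0) ⟩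
      a * 1#               ≈⟨ *-identityʳ a ⟩
      a                    ∎)
    (λ {t} Q≈a → ²-injective (*-cancelʳ c≉0 (begin
      t ² * c              ≈⟨ *-comm _ _ ⟩
      c * t ²              ≈⟨ Q≈c*² t ⟨
      quadratic c τ B t    ≈⟨ Q≈a ⟩
      a                    ≈⟨ *-identityʳ a ⟨
      a * 1#               ≈⟨ *-congˡ (trans (*-comm _ _) (inverseʳ c c≉0)) ⟨
      a * (c ⁻¹ * c)       ≈⟨ *-assoc _ _ _ ⟨
      a * c ⁻¹ * c         ≈⟨ *-congʳ r²≈a/c ⟨
      r ² * c              ∎)))
    where
    Q≈c*² : ∀ t → quadratic c τ B t ≈ c * t ²
    Q≈c*² t = begin
      c * t ² + τ * t + B      ≈⟨ +-cong (+-congˡ (*-congʳ τ≈0)) B≈0 ⟩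
      c * t ² + 0# * t + 0#    ≈⟨ solve 2 (λ c t → c :* (t :* t) :+ con false :* t :+ con false := c :* (t :* t)) refl c t ⟩
      c * t ²                  ∎

module Lines {c ℓ : Level} {m : ℕ} (F : FiniteField2 c ℓ m) where

  open import Data.Product using (Σ; _,_; proj₁; proj₂)
  open import Data.Product.Relation.Binary.Pointwise.NonDependent using (×-setoid)
  open import Relation.Binary using (Setoid; Decidable)
  open import Relation.Nullary.Decidable using (_×-dec_)
  open import Relation.Binary.PropositionalEquality using (_≡_)
  open import Data.List.Relation.Unary.Unique.Setoid using (Unique)
  import Data.List.Relation.Unary.Unique.Setoid.Properties as Unique
  open import Data.List.Membership.Setoid.Properties using (∈-cartesianProduct⁺)
  open Counting
  open import Relation.Nullary using (¬_; yes; no)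
  open import Data.Empty using (⊥-elim)

  open FiniteField2 F
  open FiniteFieldOfCharacteristic2 F
  open Characteristic2.Solver cring char2 using (solve; _:=_; _:+_; _:*_)
  open import Relation.Binary.Reasoning.Setoid setoid
  open import Data.List.Membership.Setoid (×-setoid setoid setoid) using () renaming (_∈_ to _∈ᴸ_)
  open BijectiveCounting (×-setoid setoid setoid) setoid

  LineSetoid : Setoid _ _
  LineSetoid = ×-setoid setoid setoid

  open Setoid LineSetoid public using () renaming (_≈_ to _≈ᴸ_; refl to ≈ᴸ-refl; sym to ≈ᴸ-sym; trans to ≈ᴸ-trans)

  _≟ᴸ_ : Decidable _≈ᴸ_
  (x , y) ≟ᴸ (z , u) = (x ≟ z) ×-dec (y ≟ u)

  allLines-unique : Unique LineSetoid allLines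
  allLines-unique = Unique.cartesianProduct⁺ setoid setoid unique unique

  allLines-complete : ∀ n → n ∈ᴸ allLines
  allLines-complete (x , y) = ∈-cartesianProduct⁺ setoid setoid (complete x) (complete y)

  infixl 6 _⊞_
  infixr 7 _·_

  _⊞_ : Line → Line → Line
  (x , y) ⊞ (z , u) = (x + z , y + u)

  _·_ : Carrier → Line → Line
  t · (x , y) = (t * x , t * y)

  ω : Line → Line → Carrier
  ω (x , y) (z , u) = x * u + y * z

  q : Line → Line → Carrier
  q ℓ (w₁ , w₂) = ω ℓ (w₁ , w₂) ² + w₁ * w₂

  ⊞-cong : ∀ {v v′ w w′} → v ≈ᴸ v′ → w ≈ᴸ w′ → v ⊞ w ≈ᴸ v′ ⊞ w′
  ⊞-cong (v₁≈ , v₂≈) (w₁≈ , w₂≈) = +-cong v₁≈ w₁≈ , +-cong v₂≈ w₂≈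

  ·-cong : ∀ {t t′ w w′} → t ≈ t′ → w ≈ᴸ w′ → t · w ≈ᴸ t′ · w′
  ·-cong t≈t′ (w₁≈ , w₂≈) = *-cong t≈t′ w₁≈ , *-cong t≈t′ w₂≈

  ω-cong : ∀ {v v′ w w′} → v ≈ᴸ v′ → w ≈ᴸ w′ → ω v w ≈ ω v′ w′
  ω-cong (v₁≈ , v₂≈) (w₁≈ , w₂≈) = +-cong (*-cong v₁≈ w₂≈) (*-cong v₂≈ w₁≈)

  ρ̂-congʳ : ∀ {ℓ n n′} → n ≈ᴸ n′ → ρ̂ ℓ n ≈ ρ̂ ℓ n′
  ρ̂-congʳ (n₁≈ , n₂≈) = +-cong (+-cong (*-congˡ (²-cong n₂≈)) (*-congˡ (²-cong n₁≈))) (*-cong (+-congˡ n₁≈) (+-congˡ n₂≈))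

  ⊞-involutive : ∀ ℓ w → ℓ ⊞ (ℓ ⊞ w) ≈ᴸ w
  ⊞-involutive (x , y) (w₁ , w₂) = cancel x w₁ , cancel y w₂
    where
    cancel : ∀ x w → x + (x + w) ≈ w
    cancel = solve 2 (λ x w → x :+ (x :+ w) := w) refl

  ρ̂-⊞ : ∀ ℓ w → ρ̂ ℓ (ℓ ⊞ w) ≈ q ℓ w
  ρ̂-⊞ (x , y) (w₁ , w₂) =
    solve 4 (λ x y w₁ w₂ → x :* x :* ((y :+ w₂) :* (y :+ w₂)) :+ y :* y :* ((x :+ w₁) :* (x :+ w₁)) :+ (x :+ (x :+ w₁)) :* (y :+ (y :+ w₂))
                         := (x :* w₂ :+ y :* w₁) :* (x :* w₂ :+ y :* w₁) :+ w₁ :* w₂) refl x y w₁ w₂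

  q-⊞ : ∀ ℓ d e t τ → q ℓ (t · d ⊞ τ · e) ≈ q ℓ d * t ² + τ * t * ω d e + τ ² * q ℓ e
  q-⊞ (x , y) (d₁ , d₂) (e₁ , e₂) t τ =
    solve 8 (λ x y d₁ d₂ e₁ e₂ t τ →
        (x :* (t :* d₂ :+ τ :* e₂) :+ y :* (t :* d₁ :+ τ :* e₁)) :* (x :* (t :* d₂ :+ τ :* e₂) :+ y :* (t :* d₁ :+ τ :* e₁))
          :+ (t :* d₁ :+ τ :* e₁) :* (t :* d₂ :+ τ :* e₂)
      := ((x :* d₂ :+ y :* d₁) :* (x :* d₂ :+ y :* d₁) :+ d₁ :* d₂) :* (t :* t) :+ τ :* t :* (d₁ :* e₂ :+ d₂ :* e₁)
          :+ τ :* τ :* ((x :* e₂ :+ y :* e₁) :* (x :* e₂ :+ y :* e₁) :+ e₁ :* e₂))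
      refl x y d₁ d₂ e₁ e₂ t τ

  ω[td⊞τe,d]≈τ*ω[d,e] : ∀ d e t τ → ω (t · d ⊞ τ · e) d ≈ τ * ω d e
  ω[td⊞τe,d]≈τ*ω[d,e] (d₁ , d₂) (e₁ , e₂) t τ =
    solve 6 (λ d₁ d₂ e₁ e₂ t τ → (t :* d₁ :+ τ :* e₁) :* d₂ :+ (t :* d₂ :+ τ :* e₂) :* d₁ := τ :* (d₁ :* e₂ :+ d₂ :* e₁))
      refl d₁ d₂ e₁ e₂ t τ

  ω[td⊞τe,e]≈t*ω[d,e] : ∀ d e t τ → ω (t · d ⊞ τ · e) e ≈ t * ω d e
  ω[td⊞τe,e]≈t*ω[d,e] (d₁ , d₂) (e₁ , e₂) t τ =
    solve 6 (λ d₁ d₂ e₁ e₂ t τ → (t :* d₁ :+ τ :* e₁) :* e₂ :+ (t :* d₂ :+ τ :* e₂) :* e₁ := t :* (d₁ :* e₂ :+ d₂ :* e₁))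
      refl d₁ d₂ e₁ e₂ t τ

  ω-decomposition : ∀ d e w → ω d e · w ≈ᴸ ω w e · d ⊞ ω w d · e
  ω-decomposition (d₁ , d₂) (e₁ , e₂) (w₁ , w₂) =
    solve 6 (λ d₁ d₂ e₁ e₂ w₁ w₂ → (d₁ :* e₂ :+ d₂ :* e₁) :* w₁
                                 := (w₁ :* e₂ :+ w₂ :* e₁) :* d₁ :+ (w₁ :* d₂ :+ w₂ :* d₁) :* e₁)
      refl d₁ d₂ e₁ e₂ w₁ w₂ ,
    solve 6 (λ d₁ d₂ e₁ e₂ w₁ w₂ → (d₁ :* e₂ :+ d₂ :* e₁) :* w₂
                                 := (w₁ :* e₂ :+ w₂ :* e₁) :* d₂ :+ (w₁ :* d₂ :+ w₂ :* d₁) :* e₂)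
      refl d₁ d₂ e₁ e₂ w₁ w₂

  ρ̂-triangle : ∀ ℓ n m → ρ̂ ℓ n + ρ̂ n m + ρ̂ ℓ m ≈ ω (ℓ ⊞ n) (ℓ ⊞ m) ² + ω (ℓ ⊞ n) (ℓ ⊞ m)
  ρ̂-triangle (x , y) (p , r) (z , u) =
    solve 6 (λ x y z u p r →
        (x :* x :* (r :* r) :+ y :* y :* (p :* p) :+ (x :+ p) :* (y :+ r))
          :+ (p :* p :* (u :* u) :+ r :* r :* (z :* z) :+ (p :+ z) :* (r :+ u))
          :+ (x :* x :* (u :* u) :+ y :* y :* (z :* z) :+ (x :+ z) :* (y :+ u))
      := ((x :+ p) :* (y :+ u) :+ (y :+ r) :* (x :+ z)) :* ((x :+ p) :* (y :+ u) :+ (y :+ r) :* (x :+ z))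
          :+ ((x :+ p) :* (y :+ u) :+ (y :+ r) :* (x :+ z)))
      refl x y z u p r

  -- For ω d e = 1: the Arf invariants q ℓ d * q ℓ e and x² y² ≡ x y of q in the symplectic bases
  -- (d , e) and ((1 , 0) , (0 , 1)) differ by some W² + W.
  arf : ∀ ℓ d e → let W = ω ℓ d * ω ℓ e + proj₁ d * proj₂ e in
        q ℓ d * q ℓ e + proj₁ ℓ * proj₂ ℓ * ω d e ² ≈ W ² + W * ω d e
  arf (x , y) (d₁ , d₂) (e₁ , e₂) =
    solve 6 (λ x y d₁ d₂ e₁ e₂ →
        ((x :* d₂ :+ y :* d₁) :* (x :* d₂ :+ y :* d₁) :+ d₁ :* d₂) :* ((x :* e₂ :+ y :* e₁) :* (x :* e₂ :+ y :* e₁) :+ e₁ :* e₂)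
          :+ x :* y :* ((d₁ :* e₂ :+ d₂ :* e₁) :* (d₁ :* e₂ :+ d₂ :* e₁))
      := ((x :* d₂ :+ y :* d₁) :* (x :* e₂ :+ y :* e₁) :+ d₁ :* e₂) :* ((x :* d₂ :+ y :* d₁) :* (x :* e₂ :+ y :* e₁) :+ d₁ :* e₂)
          :+ ((x :* d₂ :+ y :* d₁) :* (x :* e₂ :+ y :* e₁) :+ d₁ :* e₂) :* (d₁ :* e₂ :+ d₂ :* e₁))
      refl x y d₁ d₂ e₁ e₂

  module Configuration (ℓ m : Line) (ℓ≉m : ¬ ℓ ≈ᴸ m) where

    d : Line
    d = ℓ ⊞ m

    dual : Σ Line λ e → ω d e ≈ 1#
    dual with proj₁ d ≟ 0# | proj₂ d ≟ 0#
    ... | no d₁≉0 | _ = (0# , proj₁ d ⁻¹) , trans (+-congˡ (zeroʳ _)) (trans (+-identityʳ _) (inverseʳ _ d₁≉0))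
    ... | yes _ | no d₂≉0 = (proj₂ d ⁻¹ , 0#) , trans (+-congʳ (zeroʳ _)) (trans (+-identityˡ _) (inverseʳ _ d₂≉0))
    ... | yes d₁≈0 | yes d₂≈0 = ⊥-elim (ℓ≉m (x+y≈0⇒x≈y d₁≈0 , x+y≈0⇒x≈y d₂≈0))

    e : Line
    e = proj₁ dual

    ω[d,e]≈1 : ω d e ≈ 1#
    ω[d,e]≈1 = proj₂ dual

    x*ω[d,e]≈x : ∀ x → x * ω d e ≈ x
    x*ω[d,e]≈x x = trans (*-congˡ ω[d,e]≈1) (*-identityʳ x)

    G : Line → Carrier
    G n = ω (ℓ ⊞ n) d

    ρ̂[ℓ,m]≈q[d] : ρ̂ ℓ m ≈ q ℓ d
    ρ̂[ℓ,m]≈q[d] = trans (ρ̂-congʳ {ℓ} (≈ᴸ-sym (⊞-involutive ℓ m))) (ρ̂-⊞ ℓ d)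

    line : Carrier → Carrier → Line
    line τ t = ℓ ⊞ (t · d ⊞ τ · e)

    coordinate : Line → Carrier
    coordinate n = ω (ℓ ⊞ n) e

    ρ̂-line : ∀ τ t → ρ̂ ℓ (line τ t) ≈ quadratic (ρ̂ ℓ m) τ (τ ² * q ℓ e) t
    ρ̂-line τ t = begin
      ρ̂ ℓ (line τ t)                                        ≈⟨ ρ̂-⊞ ℓ (t · d ⊞ τ · e) ⟩
      q ℓ (t · d ⊞ τ · e)                                   ≈⟨ q-⊞ ℓ d e t τ ⟩
      q ℓ d * t ² + τ * t * ω d e + τ ² * q ℓ e             ≈⟨ +-congʳ (+-cong (*-congʳ (sym ρ̂[ℓ,m]≈q[d])) (x*ω[d,e]≈x _)) ⟩
      ρ̂ ℓ m * t ² + τ * t + τ ² * q ℓ e                     ∎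

    G-line : ∀ τ t → G (line τ t) ≈ τ
    G-line τ t = trans (ω-cong (⊞-involutive ℓ _) ≈ᴸ-refl) (trans (ω[td⊞τe,d]≈τ*ω[d,e] d e t τ) (x*ω[d,e]≈x τ))

    coordinate-line : ∀ τ t → coordinate (line τ t) ≈ t
    coordinate-line τ t = trans (ω-cong (⊞-involutive ℓ _) ≈ᴸ-refl) (trans (ω[td⊞τe,e]≈t*ω[d,e] d e t τ) (x*ω[d,e]≈x t))

    line-coordinate : ∀ {τ n} → G n ≈ τ → line τ (coordinate n) ≈ᴸ n
    line-coordinate {τ} {n} Gn≈τ = ≈ᴸ-trans (⊞-cong ≈ᴸ-refl ℓ⊞n≈) (⊞-involutive ℓ n)
      where
      ℓ⊞n≈ : coordinate n · d ⊞ τ · e ≈ᴸ ℓ ⊞ n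
      ℓ⊞n≈ = ≈ᴸ-trans (⊞-cong ≈ᴸ-refl (·-cong (sym Gn≈τ) ≈ᴸ-refl))
               (≈ᴸ-trans (≈ᴸ-sym (ω-decomposition d e (ℓ ⊞ n)))
                 (≈ᴸ-trans (·-cong ω[d,e]≈1 ≈ᴸ-refl) (*-identityˡ _ , *-identityˡ _)))

    count-slice : ∀ a τ → count (λ n → (ρ̂ ℓ n ≟ a) ×-dec (G n ≟ τ)) allLines
                        ≡ count (λ t → quadratic (ρ̂ ℓ m) τ (τ ² * q ℓ e) t ≟ a) elems
    count-slice a τ = count-bijection _≟ᴸ_ _≟_ _ _ allLines-unique unique allLines-complete complete
      (λ n≈n′ (ρ̂≈a , G≈τ) → trans (sym (ρ̂-congʳ {ℓ} n≈n′)) ρ̂≈a , trans (sym (G-cong n≈n′)) G≈τ)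
      (λ t≈t′ Q≈a → trans (sym (quadratic-cong t≈t′)) Q≈a)
      coordinate (line τ) (λ n≈n′ → ω-cong (⊞-cong ≈ᴸ-refl n≈n′) ≈ᴸ-refl)
      (λ t≈t′ → ⊞-cong ≈ᴸ-refl (⊞-cong (·-cong t≈t′ ≈ᴸ-refl) ≈ᴸ-refl))
      (λ {n} (ρ̂≈a , G≈τ) → trans (sym (ρ̂-line τ (coordinate n))) (trans (ρ̂-congʳ {ℓ} (line-coordinate G≈τ)) ρ̂≈a))
      (λ {t} Q≈a → trans (ρ̂-line τ t) Q≈a , G-line τ t)
      (λ (_ , G≈τ) → line-coordinate G≈τ)
      (λ {t} _ → coordinate-line τ t)
      where
      G-cong : ∀ {n n′} → n ≈ᴸ n′ → G n ≈ G n′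
      G-cong n≈n′ = ω-cong (⊞-cong ≈ᴸ-refl n≈n′) ≈ᴸ-refl

    Tr-arf : Tr (ρ̂ ℓ m * q ℓ e) ≈ Tr (proj₁ ℓ * proj₂ ℓ)
    Tr-arf = x+y≈0⇒x≈y (begin
      Tr (ρ̂ ℓ m * q ℓ e) + Tr (proj₁ ℓ * proj₂ ℓ)    ≈⟨ Tr-homo-+ _ _ ⟨
      Tr (ρ̂ ℓ m * q ℓ e + proj₁ ℓ * proj₂ ℓ)         ≈⟨ Tr-cong (begin
          ρ̂ ℓ m * q ℓ e + proj₁ ℓ * proj₂ ℓ                        ≈⟨ +-cong (*-congʳ ρ̂[ℓ,m]≈q[d]) (sym xy*ω²≈xy) ⟩
          q ℓ d * q ℓ e + proj₁ ℓ * proj₂ ℓ * ω d e ²              ≈⟨ arf ℓ d e ⟩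
          W ² + W * ω d e                                          ≈⟨ +-congˡ (x*ω[d,e]≈x W) ⟩
          W ² + W                                                  ∎) ⟩
      Tr (W ² + W)                                   ≈⟨ Tr-℘ W ⟩
      0#                                             ∎)
      where
      W : Carrier
      W = ω ℓ d * ω ℓ e + proj₁ d * proj₂ e
      xy*ω²≈xy : proj₁ ℓ * proj₂ ℓ * ω d e ² ≈ proj₁ ℓ * proj₂ ℓ
      xy*ω²≈xy = trans (sym (*-assoc _ _ _)) (trans (x*ω[d,e]≈x _) (x*ω[d,e]≈x _))

    G²+G≈a+b+c : ∀ {a b c n} → ρ̂ ℓ m ≈ c → ρ̂ ℓ n ≈ a → ρ̂ n m ≈ b → G n ² + G n ≈ a + b + c
    G²+G≈a+b+c {n = n} ρ̂ℓm≈c ρ̂ℓn≈a ρ̂nm≈b = trans (sym (ρ̂-triangle ℓ n m)) (+-cong (+-cong ρ̂ℓn≈a ρ̂nm≈b) ρ̂ℓm≈c)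

    G²+G≈a+b+c⇒ρ̂[n,m]≈b : ∀ {a b c n} → ρ̂ ℓ m ≈ c → ρ̂ ℓ n ≈ a → G n ² + G n ≈ a + b + c → ρ̂ n m ≈ b
    G²+G≈a+b+c⇒ρ̂[n,m]≈b {a} {b} {c} {n} ρ̂ℓm≈c ρ̂ℓn≈a G²+G≈s = begin
      ρ̂ n m                                    ≈⟨ solve 3 (λ A B C → B := (A :+ B :+ C) :+ (A :+ C)) refl (ρ̂ ℓ n) (ρ̂ n m) (ρ̂ ℓ m) ⟩
      ρ̂ ℓ n + ρ̂ n m + ρ̂ ℓ m + (ρ̂ ℓ n + ρ̂ ℓ m)  ≈⟨ +-cong (trans (ρ̂-triangle ℓ n m) G²+G≈s) (+-cong ρ̂ℓn≈a ρ̂ℓm≈c) ⟩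
      a + b + c + (a + c)                      ≈⟨ solve 3 (λ a b c → a :+ b :+ c :+ (a :+ c) := b) refl a b c ⟩
      b                                        ∎

module CountingLines {c ℓ : Level} {m : ℕ} (F : FiniteField2 c ℓ m) where

  open import Data.Bool using (false; true)
  open import Data.List using (length)
  import Data.List.Relation.Unary.All as All
  open import Data.List.Relation.Unary.All.Properties using (all-filter)
  open import Data.List.Membership.Setoid.Properties using (∈-filter⁺)
  import Data.List.Relation.Unary.Unique.Setoid.Properties as Unique
  open import Relation.Nullary using (Dec; yes; no)
  open import Relation.Unary using (Pred; Decidable)
  open import Relation.Nullary.Decidable using (_×-dec_; ¬?)
  open import Data.Empty using (⊥-elim)
  import Data.Nat.Properties as ℕ

  open FiniteField2 F
  open FiniteFieldOfCharacteristic2 F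
  open Lines F
  open Counting
  open SetoidCounting setoid _≟_ using (count-partition; count-≡1)
  open Characteristic2.Solver cring char2 using (solve; _:=_; _:+_; _:*_; con)

  solCount-zero : ∀ {v w τ} → τ ≈ 0# → solCount v w τ ≡ 1
  solCount-zero {τ = τ} τ≈0 with τ ≟ 0#
  ... | yes _ = ≡.refl
  ... | no τ≉0 = ⊥-elim (τ≉0 τ≈0)

  solCount-nonzero : ∀ {v w τ} → ¬ τ ≈ 0# → solCount v w τ ≡ length (rootsOf (v + w * (τ ²) ⁻¹))
  solCount-nonzero {τ = τ} τ≉0 with τ ≟ 0#
  ... | yes τ≈0 = ⊥-elim (τ≉0 τ≈0)
  ... | no _ = ≡.refl

  solCount≡2*inT : ∀ {e v w τ} → Tr v ≈ ⟦ e ⟧ → ¬ τ ≈ 0# → solCount v w τ ≡ 2 N.* inT e (w * (τ ²) ⁻¹)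
  solCount≡2*inT {e} {v} {w} {τ} Trv≈e τ≉0 =
    ≡.trans (solCount-nonzero τ≉0) (≡.trans (artin-schreier _) (≡.cong (2 N.*_) (shift (w * (τ ²) ⁻¹))))
    where
    shift : ∀ x → inT false (v + x) ≡ inT e x
    shift x with Tr x ≟ ⟦ e ⟧ | Tr (v + x) ≟ 0#
    ... | yes _ | yes _ = ≡.refl
    ... | no _ | no _ = ≡.refl
    ... | yes Trx≈e | no Tr[v+x]≉0 = ⊥-elim (Tr[v+x]≉0 (trans (Tr-homo-+ v x) (x≈y⇒x+y≈0 (trans Trv≈e (sym Trx≈e)))))
    ... | no Trx≉e | yes Tr[v+x]≈0 = ⊥-elim (Trx≉e (trans (sym (x+y≈0⇒x≈y (trans (sym (Tr-homo-+ v x)) Tr[v+x]≈0))) Trv≈e))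

  count-quadratic≡solCount : ∀ {v a c E} τ → ¬ c ≈ 0# → Tr (c * E) ≈ Tr v →
    count (λ t → quadratic c τ (τ ² * E) t ≟ a) elems ≡ solCount v (a * c) τ
  count-quadratic≡solCount {v} {a} {c} {E} τ c≉0 TrcE≈Trv with τ ≟ 0#
  ... | yes τ≈0 = count-quadratic-degenerate c≉0 τ≈0 (trans (*-congʳ (*-cong τ≈0 τ≈0)) (trans (*-congʳ (zeroˡ 0#)) (zeroˡ E)))
  ... | no τ≉0 = ≡.trans (count-quadratic c≉0 τ≉0) (|rootsOf|-cong-Tr (begin
    Tr (c * J * (a + τ ² * E))       ≈⟨ Tr-cong (solve 5 (λ c J a T E → c :* J :* (a :+ T :* E) := a :* c :* J :+ (T :* J) :* (c :* E))
                                                  refl c J a (τ ²) E) ⟩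
    Tr (a * c * J + τ ² * J * (c * E)) ≈⟨ Tr-cong (+-congˡ (trans (*-congʳ (inverseʳ (τ ²) (*-nonzero τ≉0 τ≉0))) (*-identityˡ _))) ⟩
    Tr (a * c * J + c * E)           ≈⟨ Tr-homo-+ _ _ ⟩
    Tr (a * c * J) + Tr (c * E)      ≈⟨ +-congˡ TrcE≈Trv ⟩
    Tr (a * c * J) + Tr v            ≈⟨ +-comm _ _ ⟩
    Tr v + Tr (a * c * J)            ≈⟨ Tr-homo-+ _ _ ⟨
    Tr (v + a * c * J)               ∎))
    where
    open import Relation.Binary.Reasoning.Setoid setoid
    J : Carrier
    J = (τ ²) ⁻¹

  module _ {ℓ′ m′ : Line} (ℓ≉m : ¬ ℓ′ ≈ᴸ m′) {a b c′ : Carrier} (ρ̂ℓm≈c : ρ̂ ℓ′ m′ ≈ c′) (c≉0 : ¬ c′ ≈ 0#)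
           {v : Carrier} (TrcE≈Trv : Tr (c′ * q ℓ′ (Configuration.e ℓ′ m′ ℓ≉m)) ≈ Tr v) where
    open Configuration ℓ′ m′ ℓ≉m

    countπ≡sum-solCount : countπ ℓ′ m′ a b ≡ sum (map (solCount v (a * c′)) (rootsOf (a + b + c′)))
    countπ≡sum-solCount = ≡.trans
      (count-partition P? G allLines (rootsOf s) (Unique.filter⁺ setoid (℘-root? s) unique)
        (λ {n} (ρ̂ℓn≈a , ρ̂nm≈b) → ∈-filter⁺ setoid (℘-root? s) (λ τ≈τ′ ℘τ≈s → trans (sym (℘-cong τ≈τ′)) ℘τ≈s)
                                   (complete (G n)) (G²+G≈a+b+c ρ̂ℓm≈c ρ̂ℓn≈a ρ̂nm≈b)))
      (sum-cong (All.map slice (all-filter (℘-root? s) elems)))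
      where
      s : Carrier
      s = a + b + c′
      P? : ∀ n → Dec ((ρ̂ ℓ′ n ≈ a) × (ρ̂ n m′ ≈ b))
      P? n = (ρ̂ ℓ′ n ≟ a) ×-dec (ρ̂ n m′ ≟ b)
      slice : ∀ {τ} → τ ² + τ ≈ s → count (λ n → P? n ×-dec (G n ≟ τ)) allLines ≡ solCount v (a * c′) τ
      slice {τ} ℘τ≈s = begin
        count (λ n → P? n ×-dec (G n ≟ τ)) allLines
          ≡⟨ count-cong _ _ ( (λ ((ρ̂ℓn≈a , _) , Gn≈τ) → ρ̂ℓn≈a , Gn≈τ)
                            , (λ (ρ̂ℓn≈a , Gn≈τ) → (ρ̂ℓn≈a , ρ̂[n,m]≈b ρ̂ℓn≈a Gn≈τ) , Gn≈τ)) allLines ⟩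
        count (λ n → (ρ̂ ℓ′ n ≟ a) ×-dec (G n ≟ τ)) allLines
          ≡⟨ count-slice a τ ⟩
        count (λ t → quadratic (ρ̂ ℓ′ m′) τ (τ ² * q ℓ′ e) t ≟ a) elems
          ≡⟨ count-cong _ _ ((λ Q≈a → trans (sym Q≈Q′) Q≈a) , (λ Q′≈a → trans Q≈Q′ Q′≈a)) elems ⟩
        count (λ t → quadratic c′ τ (τ ² * q ℓ′ e) t ≟ a) elems
          ≡⟨ count-quadratic≡solCount τ c≉0 TrcE≈Trv ⟩
        solCount v (a * c′) τ ∎
        where
        open ≡.≡-Reasoning
        ρ̂[n,m]≈b : ∀ {n} → ρ̂ ℓ′ n ≈ a → G n ≈ τ → ρ̂ n m′ ≈ b
        ρ̂[n,m]≈b ρ̂ℓn≈a Gn≈τ = G²+G≈a+b+c⇒ρ̂[n,m]≈b ρ̂ℓm≈c ρ̂ℓn≈a (trans (℘-cong Gn≈τ) ℘τ≈s)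
        Q≈Q′ : ∀ {t} → quadratic (ρ̂ ℓ′ m′) τ (τ ² * q ℓ′ e) t ≈ quadratic c′ τ (τ ² * q ℓ′ e) t
        Q≈Q′ = +-congʳ (+-congʳ (*-congʳ ρ̂ℓm≈c))

  module _ {e : Bool} {v : Carrier} (Trv≈e : Tr v ≈ ⟦ e ⟧) (w : Carrier) where

    sum-solCount-s≉0 : ∀ {s} → ¬ s ≈ 0# →
      sum (map (solCount v w) (rootsOf s)) ≡ 2 N.* sum (map (λ τ → inT e (w * (τ ²) ⁻¹)) (rootsOf s))
    sum-solCount-s≉0 {s} s≉0 = ≡.trans
      (sum-cong (All.map (λ ℘τ≈s → solCount≡2*inT Trv≈e (λ τ≈0 → s≉0 (trans (sym ℘τ≈s) (℘≈0 τ≈0))))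
                         (all-filter (℘-root? s) elems)))
      (sum-*ˡ 2 (λ τ → inT e (w * (τ ²) ⁻¹)) (rootsOf s))
      where
      ℘≈0 : ∀ {τ} → τ ≈ 0# → τ ² + τ ≈ 0#
      ℘≈0 {τ} τ≈0 = trans (+-cong (²-cong τ≈0) τ≈0) (trans (+-congʳ (zeroˡ 0#)) (+-identityʳ 0#))

    sum-solCount-s≈0 : ∀ {s} → s ≈ 0# → sum (map (solCount v w) (rootsOf s)) ≡ 1 N.+ 2 N.* inT e w
    sum-solCount-s≈0 {s} s≈0 = ≡.trans
      (sum-two-valued (_≟ 0#) (solCount v w) 1 (2 N.* inT e w) (rootsOf s)
        (All.map (λ ℘τ≈s → solCount-zero
                         , λ τ≉0 → ≡.trans (solCount≡2*inT Trv≈e τ≉0) (≡.cong (2 N.*_) (inT-cong e (w/τ²≈w ℘τ≈s τ≉0))))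
                 (all-filter (℘-root? s) elems)))
      (≡.trans (≡.cong₂ (λ i j → i N.* 1 N.+ j N.* (2 N.* inT e w))
                 (one-root (_≟ 0#) (λ x≈y x≈0 → trans (sym x≈y) x≈0) 0# (℘0≈s , refl) (λ _ τ≈0 → τ≈0))
                 (one-root (λ τ → ¬? (τ ≟ 0#)) (λ x≈y x≉0 y≈0 → x≉0 (trans x≈y y≈0)) 1# (℘1≈s , 1≉0) τ≈1))
               (≡.cong (1 N.+_) (ℕ.*-identityˡ _)))
      where
      ℘0≈s : 0# ² + 0# ≈ s
      ℘0≈s = trans (trans (+-congʳ (zeroˡ 0#)) (+-identityʳ 0#)) (sym s≈0)
      ℘1≈s : 1# ² + 1# ≈ s
      ℘1≈s = trans (trans (+-congʳ (*-identityˡ 1#)) char2) (sym s≈0)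
      τ≈1 : ∀ {τ} → τ ² + τ ≈ s → ¬ τ ≈ 0# → τ ≈ 1#
      τ≈1 {τ} ℘τ≈s τ≉0 = x+y≈0⇒x≈y (x*y≈0⇒y≈0 τ≉0
        (trans (solve 1 (λ τ → τ :* (τ :+ con true) := τ :* τ :+ τ) refl τ) (trans ℘τ≈s s≈0)))
      w/τ²≈w : ∀ {τ} → τ ² + τ ≈ s → ¬ τ ≈ 0# → w * (τ ²) ⁻¹ ≈ w
      w/τ²≈w {τ} ℘τ≈s τ≉0 =
        trans (*-congˡ (trans (⁻¹-cong (*-nonzero τ≉0 τ≉0) τ²≈1) (sym (⁻¹-unique 1≉0 (*-identityˡ 1#))))) (*-identityʳ w)
        where
        τ²≈1 : τ ² ≈ 1#
        τ²≈1 = trans (²-cong (τ≈1 ℘τ≈s τ≉0)) (*-identityˡ 1#)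
      one-root : ∀ {p} {P : Pred Carrier p} (P? : Decidable P) → (∀ {x y} → x ≈ y → P x → P y) →
        ∀ r → (r ² + r ≈ s) × P r → (∀ {τ} → τ ² + τ ≈ s → P τ → τ ≈ r) → count P? (rootsOf s) ≡ 1
      one-root P? P-resp r (℘r≈s , pr) only-r = ≡.trans (count-filter P? (℘-root? s) elems)
        (count-≡1 (λ τ → ℘-root? s τ ×-dec P? τ) (λ τ≈τ′ (℘τ≈s , pτ) → trans (sym (℘-cong τ≈τ′)) ℘τ≈s , P-resp τ≈τ′ pτ)
          unique r (complete r) (℘r≈s , pr) (λ (℘τ≈s , pτ) → only-r ℘τ≈s pτ))

mainTheorem14 : ∀ {c ℓ : Level} (m : ℕ) (F : FiniteField2 c ℓ m) →
  let open FiniteField2 F in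
  (a b c' : Carrier) → Tr ((a ⊕ b) ⊕ c') ≈ 0# → ¬ (c' ≈ 0#) →
  (e : Bool) (v : Carrier) → Tr v ≈ ⟦ e ⟧ →
  (x y z u : Carrier) → ¬ ((x ≈ z) × (y ≈ u)) →
  Tr (x ⊗ y) ≈ ⟦ e ⟧ → ρ̂ (x , y) (z , u) ≈ c' →
  let π = countπ (x , y) (z , u) a b
      s = (a ⊕ b) ⊕ c'
  in (π ≡ sum (map (solCount v (a ⊗ c')) (rootsOf s)))
     × ((s ≈ 0# → π ≡ 1 N.+ 2 N.* inT e (a ⊗ c'))
     × (¬ (s ≈ 0#) → π ≡ 2 N.* sum (map (λ τ → inT e ((a ⊗ c') ⊗ ((τ ²) ⁻¹))) (rootsOf s))))
mainTheorem14 m F a b c' _ c'≉0 e v Trv≈e x y z u ℓ≉m Trxy≈e ρ̂ℓm≈c' =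
  π≡Σ , (λ s≈0 → ≡.trans π≡Σ (sum-solCount-s≈0 Trv≈e (a * c') s≈0))
      , (λ s≉0 → ≡.trans π≡Σ (sum-solCount-s≉0 Trv≈e (a * c') s≉0))
  where
  open FiniteField2 F
  open CountingLines F
  open FiniteFieldOfCharacteristic2 F using (Tr-cong)
  open Lines F using (module Configuration)
  open Configuration (x , y) (z , u) ℓ≉m using (Tr-arf)
  π≡Σ : countπ (x , y) (z , u) a b ≡ sum (map (solCount v (a * c')) (rootsOf (a + b + c')))
  π≡Σ = countπ≡sum-solCount ℓ≉m ρ̂ℓm≈c' c'≉0
          (trans (Tr-cong (*-congʳ (sym ρ̂ℓm≈c'))) (trans Tr-arf (trans Trxy≈e (sym Trv≈e))))
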